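{- Let $r,p\ge1$, $\bm{x}_1,\ldots,\bm{x}_r\in\mathbb{C}^p$ and $t_1,\ldots,t_{p-1}\in\mathbb{C}\setminus\{0,-1,-2,\ldots\}$. Then $$\nabla f^{t_1,\ldots,t_{p-1}}_{\bm{x}_1;\cdots;\bm{x}_r}=f^{t_1,\ldots,t_{p-1}}_{\bm{1}-\bm{x}_1;\cdots;\bm{1}-\bm{x}_r},$$ where $\bm{1}-\bm{x}=(1-x_1,\ldots,1-x_p)$ for $\bm{x}=(x_1,\ldots,x_p)$.
   Context: $\mathbb{N}=\{0,1,2,\ldots\}$; $0^0=1$. For complex $z$ and $m\in\mathbb{N}$, $\binom{z}{m}=z(z-1)\cdots(z-m+1)/m!$; multinomial coefficients are $\binom{n}{\nu_1,\ldots,\nu_p}=n!/(\nu_1!\cdots\nu_p!)$. For $\bm{x}_i=(x_{i1},\ldots,x_{ip})$ and $n_1,\ldots,n_r\in\mathbb{N}$ define $$c^{t_1,\ldots,t_{p-1}}_{\bm{x}_1;\cdots;\bm{x}_r}(n_1,\ldots,n_r)=\sum\frac{\prod_{i=1}^r\binom{n_i}{\nu_{i1},\ldots,\nu_{ip}}x_{i1}^{\nu_{i1}}\cdots x_{ip}^{\nu_{ip}}}{\prod_{j=1}^{p-1}\binom{n_{1j}+\cdots+n_{rj}+t_j-1}{\nu_{1j}+\cdots+\nu_{rj}}(n_{1j}+\cdots+n_{rj}+t_j)},$$ summing over all integers $n_{ij}$ with $n_i=n_{i1}\ge n_{i2}\ge\cdots\ge n_{ip}\ge0$ for each $i$, where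 $\nu_{ij}=n_{ij}-n_{i,j+1}$ for $j<p$, $\nu_{ip}=n_{ip}$ (for $p=1$ it equals $x_1^{n_1}\cdots x_r^{n_r}$). Let $f^{t_1,\ldots,t_{p-1}}_{\bm{x}_1;\cdots;\bm{x}_r}=\sum_{n}c^{t_1,\ldots,t_{p-1}}_{\bm{x}_1;\cdots;\bm{x}_r}(n_1,\ldots,n_r)\frac{X_1^{n_1}\cdots X_r^{n_r}}{n_1!\cdots n_r!}$. For a sequence $a\colon\mathbb{N}^r\to\mathbb{C}$, $(\Delta_i a)(n_1,\ldots,n_r)=a(n_1,\ldots,n_r)-a(n_1,\ldots,n_i+1,\ldots,n_r)$ and $(\nabla a)(n_1,\ldots,n_r)=(\Delta_1^{n_1}\cdots\Delta_r^{n_r}a)(0,\ldots,0)$; for $f=\sum_na(n)\frac{X_1^{n_1}\cdots X_r^{n_r}}{n_1!\cdots n_r!}$, $\nabla f=\sum_n(\nabla a)(n)\frac{X_1^{n_1}\cdots X_r^{n_r}}{n_1!\cdots n_r!}$. -}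

module Defs where

open import Level using (Level; _⊔_)
open import Data.Nat as ℕ using (ℕ; zero; suc; _∸_; _!)
open import Data.Fin using (Fin; zero; suc; inject₁; _≟_)
open import Data.List using (List; []; _∷_; map; concatMap; upTo; allFin; foldr)
open import Data.Vec.Functional using () renaming (_∷_ to _∷ᵛ_)
open import Function using (_∘_; id)
open import Relation.Nullary using (¬_; yes; no)
open import Algebra.Bundles using (CommutativeRing)

ringℕ : ∀ {c ℓ} (R : CommutativeRing c ℓ) → ℕ → CommutativeRing.Carrier R
ringℕ R zero    = CommutativeRing.0# R
ringℕ R (suc n) = CommutativeRing._+_ R (CommutativeRing.1# R) (ringℕ R n)

-- A field of characteristic zero (e.g. ℂ).  The inverse is a total
-- operation, only specified on nonzero elements.
record CharZeroField (c ℓ : Level) : Set (Level.suc (c ⊔ ℓ)) where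
  field
    commRing : CommutativeRing c ℓ
  open CommutativeRing commRing public using (Carrier; _≈_; _+_; _*_; -_; _-_; 0#; 1#)
  field
    _⁻¹      : Carrier → Carrier
    inverseʳ : ∀ x → ¬ (x ≈ 0#) → (x * (x ⁻¹)) ≈ 1#
    charZero : ∀ n → ¬ (ringℕ commRing (suc n) ≈ 0#)

module Ops {c ℓ} (F : CharZeroField c ℓ) where
  open CharZeroField F public

  fromℕ : ℕ → Carrier
  fromℕ = ringℕ commRing

  _/_ : Carrier → Carrier → Carrier
  a / b = a * (b ⁻¹)

  pow : Carrier → ℕ → Carrier
  pow x zero    = 1#
  pow x (suc n) = x * pow x n

  sumL : List Carrier → Carrier
  sumL = foldr _+_ 0#

  sumFin : ∀ n → (Fin n → Carrier) → Carrier
  sumFin zero    f = 0#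
  sumFin (suc n) f = f zero + sumFin n (f ∘ suc)

  prodFin : ∀ n → (Fin n → Carrier) → Carrier
  prodFin zero    f = 1#
  prodFin (suc n) f = f zero * prodFin n (f ∘ suc)

  sumℕ : ∀ n → (Fin n → ℕ) → ℕ
  sumℕ zero    f = 0
  sumℕ (suc n) f = f zero ℕ.+ sumℕ n (f ∘ suc)

  falling : Carrier → ℕ → Carrier
  falling z zero    = 1#
  falling z (suc m) = falling z m * (z - fromℕ m)

  binom : Carrier → ℕ → Carrier
  binom z m = falling z m / fromℕ (m !)

  multinom : ∀ {p} → ℕ → (Fin p → ℕ) → Carrier
  multinom {p} n ν = fromℕ (n !) / prodFin p (λ j → fromℕ (ν j !))

  chainsBelow : (q : ℕ) → ℕ → List (Fin q → ℕ)
  chainsBelow zero    b = (λ ()) ∷ []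
  chainsBelow (suc q) b = concatMap (λ k → map (k ∷ᵛ_) (chainsBelow q k)) (upTo (suc b))

  -- all chains n = n₁ ≥ n₂ ≥ ⋯ ≥ n_p ≥ 0 (p = suc q)
  chains : (q : ℕ) → ℕ → List (Fin (suc q) → ℕ)
  chains q n = map (n ∷ᵛ_) (chainsBelow q n)

  nextEntry : ∀ {q} → (Fin (suc q) → ℕ) → Fin (suc q) → ℕ
  nextEntry {zero}  ch zero    = 0
  nextEntry {suc q} ch zero    = ch (suc zero)
  nextEntry {suc q} ch (suc j) = nextEntry {q} (ch ∘ suc) j

  -- ν_j = n_j - n_{j+1} (j < p), ν_p = n_p
  nu : ∀ {q} → (Fin (suc q) → ℕ) → Fin (suc q) → ℕ
  nu ch j = ch j ∸ nextEntry ch j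

  tuples : ∀ {a} {A : Set a} (r : ℕ) → (Fin r → List A) → List (Fin r → A)
  tuples zero    L = (λ ()) ∷ []
  tuples (suc r) L = concatMap (λ a → map (a ∷ᵛ_) (tuples r (L ∘ suc))) (L zero)

  -- the coefficient c^{t_1..t_{p-1}}_{x_1;...;x_r}(n_1,...,n_r), with p = suc q.
  -- Index j : Fin q stands for the paper's j ∈ {1,…,p-1} (position inject₁ j).
  coeff : ∀ {r q} → (Fin q → Carrier) → (Fin r → Fin (suc q) → Carrier)
          → (Fin r → ℕ) → Carrier
  coeff {r} {q} t x n = sumL (map term (tuples r (λ i → chains q (n i))))
    where
    term : (Fin r → Fin (suc q) → ℕ) → Carrier
    term N = num / den
      where
      num = prodFin r (λ i → multinom (n i) (nu (N i))
                              * prodFin (suc q) (λ j → pow (x i j) (nu (N i) j)))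
      S : Fin q → Carrier
      S j = fromℕ (sumℕ r (λ i → N i (inject₁ j))) + t j
      M : Fin q → ℕ
      M j = sumℕ r (λ i → nu (N i) (inject₁ j))
      den = prodFin q (λ j → binom (S j - 1#) (M j) * S j)

  bump : ∀ {r} → Fin r → (Fin r → ℕ) → Fin r → ℕ
  bump i m j with j ≟ i
  ... | yes _ = suc (m j)
  ... | no  _ = m j

  Δ : ∀ {r} → Fin r → ((Fin r → ℕ) → Carrier) → (Fin r → ℕ) → Carrier
  Δ i a m = a m - a (bump i m)

  iter : ∀ {a} {A : Set a} → ℕ → (A → A) → A → A
  iter zero    f = id
  iter (suc k) f = f ∘ iter k f

  -- (∇a)(n) = (Δ_1^{n_1} ⋯ Δ_r^{n_r} a)(0,…,0)
  nabla : ∀ {r} → ((Fin r → ℕ) → Carrier) → (Fin r → ℕ) → Carrier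
  nabla {r} a n = foldr (λ i g → iter (n i) (Δ i) ∘ g) id (allFin r) a (λ _ → 0)

  oneMinus : ∀ {r p} → (Fin r → Fin p → Carrier) → Fin r → Fin p → Carrier
  oneMinus x i j = 1# - x i j

{-# OPTIONS --safe #-}
-- Summing over the chain of the first row leaves a coefficient of the same shape for the remaining
-- rows, with the denominators shifted by the first row's exponents.  Each denominator contributes a
-- factor β(d, b) = 1 / (C(d + b + τ - 1, d) (d + b + τ)), which satisfies the Pascal rule
-- β(d, b) = β(d + 1, b) + β(d, b + 1); hence so does the coefficient in every shift coordinate.
-- On the first row, ∇ acts as Δⁿ = Σⱼ C(n, j) (-1)ʲ Eʲ, and for an array h obeying Pascal's rule
--   Σⱼ C(K, j) (-x)ʲ h(d + j, b) = Σₐ C(K, a) (1 - x)^(K - a) h(d + K - a, b + a),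
-- a two-variable binomial theorem.  Splitting off the chain entries one at a time with this
-- identity, and then the rows one at a time, turns every x into 1 - x.
module Submission where

open import Defs
open import Level using (_⊔_)
open import Data.Nat as ℕ using (ℕ; zero; suc; _≤_; _<_; z≤n; s≤s)
import Data.Nat.Properties as ℕₚ
open import Data.Integer as ℤ using (ℤ; +_; -[1+_]; _⊖_)
import Data.Integer.Properties as ℤₚ
open import Data.Sign as Sign using (Sign)
open import Data.Maybe using (Maybe; just; nothing)
open import Data.Fin using (Fin; zero; suc; _≟_; inject₁)
open import Data.Vec.Functional using () renaming (_∷_ to _∷ᵛ_)
open import Function using (_∘_; id)
open import Data.List using (List; []; _∷_; map; concatMap; applyUpTo; upTo; _++_; foldr; tabulate)
import Data.List.Properties as List
open import Data.List.Relation.Unary.All using (All; []; _∷_)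
open import Data.Nat.Combinatorics using (_C_; k>n⇒nCk≡0; nCk+nC[k+1]≡[n+1]C[k+1])
open import Relation.Binary.PropositionalEquality as ≡ using (_≡_; _≢_)
open import Relation.Nullary using (¬_; yes; no)
open import Data.Empty using (⊥-elim)
import Data.Fin.Properties as Fin
import Data.List.Relation.Unary.All as All
import Data.List.Relation.Unary.All.Properties as All
open import Algebra.Bundles using (CommutativeRing; RawRing)
open import Algebra.Solver.Ring.AlmostCommutativeRing using (fromCommutativeRing; _-Raw-AlmostCommutative⟶_)
import Algebra.Solver.Ring

module BinomialCoefficients where

  open import Data.Nat
  open import Data.Nat.Properties
  open import Data.Nat.Combinatorics using (nCk≡n!/k![n-k]!; k![n∸k]!∣n!)
  open import Data.Nat.DivMod using (m/n*n≡m)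
  open import Data.Nat.Tactic.RingSolver using (solve-∀)
  open import Relation.Binary.PropositionalEquality
  open import Relation.Nullary using (yes; no)

  nCk*[k!*[n∸k]!]≡n! : ∀ {n k} → k ≤ n → (n C k) * (k ! * (n ∸ k) !) ≡ n !
  nCk*[k!*[n∸k]!]≡n! {n} {k} k≤n = begin
    (n C k) * (k ! * (n ∸ k) !)                 ≡⟨ cong (_* (k ! * (n ∸ k) !)) (nCk≡n!/k![n-k]! k≤n) ⟩
    n ! / (k ! * (n ∸ k) !) * (k ! * (n ∸ k) !) ≡⟨ m/n*n≡m (k![n∸k]!∣n! k≤n) ⟩
    n !                                         ∎
    where
    open ≡-Reasoning
    instance _ = m*n≢0 (k !) ((n ∸ k) !) {{k !≢0}} {{(n ∸ k) !≢0}}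

  nC[j+k]*[j+k]Cj≡nCj*[n∸j]Ck : ∀ {n} j k → j ≤ n → (n C (j + k)) * ((j + k) C j) ≡ (n C j) * ((n ∸ j) C k)
  nC[j+k]*[j+k]Cj≡nCj*[n∸j]Ck {n} j k j≤n with k ≤? n ∸ j
  ... | no k≰n∸j = begin
    (n C (j + k)) * ((j + k) C j) ≡⟨ cong (_* ((j + k) C j)) (k>n⇒nCk≡0 n<j+k) ⟩
    0                             ≡⟨ *-zeroʳ (n C j) ⟨
    (n C j) * 0                   ≡⟨ cong ((n C j) *_) (k>n⇒nCk≡0 (≰⇒> k≰n∸j)) ⟨
    (n C j) * ((n ∸ j) C k)       ∎
    where
    open ≡-Reasoning
    n<j+k : n < j + k
    n<j+k = subst (_< j + k) (m+[n∸m]≡n j≤n) (+-monoʳ-< j (≰⇒> k≰n∸j))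
  ... | yes k≤n∸j = *-cancelʳ-≡ _ _ (j ! * k ! * l !) {{j!k!l!≢0}} (begin
    (n C (j + k)) * ((j + k) C j) * (j ! * k ! * l !)
      ≡⟨ reassoc (n C (j + k)) ((j + k) C j) (j !) (k !) (l !) ⟩
    (n C (j + k)) * (((j + k) C j) * (j ! * k !) * l !)
      ≡⟨ cong (λ z → (n C (j + k)) * (z * l !)) ([j+k]Cj*[j!*k!]≡[j+k]! j k) ⟩
    (n C (j + k)) * ((j + k) ! * l !)
      ≡⟨ cong (λ z → (n C (j + k)) * ((j + k) ! * z !)) l≡n∸[j+k] ⟩
    (n C (j + k)) * ((j + k) ! * (n ∸ (j + k)) !)
      ≡⟨ nCk*[k!*[n∸k]!]≡n! j+k≤n ⟩
    n !
      ≡⟨ nCk*[k!*[n∸k]!]≡n! j≤n ⟨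
    (n C j) * (j ! * (n ∸ j) !)
      ≡⟨ cong (λ z → (n C j) * (j ! * z)) (nCk*[k!*[n∸k]!]≡n! k≤n∸j) ⟨
    (n C j) * (j ! * (((n ∸ j) C k) * (k ! * l !)))
      ≡⟨ reassoc₂ (n C j) ((n ∸ j) C k) (j !) (k !) (l !) ⟩
    (n C j) * ((n ∸ j) C k) * (j ! * k ! * l !) ∎)
    where
    open ≡-Reasoning
    l = n ∸ j ∸ k
    j+k≤n : j + k ≤ n
    j+k≤n = subst (j + k ≤_) (m+[n∸m]≡n j≤n) (+-monoʳ-≤ j k≤n∸j)
    l≡n∸[j+k] : l ≡ n ∸ (j + k)
    l≡n∸[j+k] = ∸-+-assoc n j k
    [j+k]Cj*[j!*k!]≡[j+k]! : ∀ j k → ((j + k) C j) * (j ! * k !) ≡ (j + k) !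
    [j+k]Cj*[j!*k!]≡[j+k]! j k = subst (λ z → ((j + k) C j) * (j ! * z !) ≡ (j + k) !) (m+n∸m≡n j k) (nCk*[k!*[n∸k]!]≡n! (m≤m+n j k))
    j!k!l!≢0 : NonZero (j ! * k ! * l !)
    j!k!l!≢0 = m*n≢0 _ _ {{m*n≢0 _ _ {{j !≢0}} {{k !≢0}}}} {{l !≢0}}
    reassoc : ∀ a b x y z → a * b * (x * y * z) ≡ a * (b * (x * y) * z)
    reassoc = solve-∀
    reassoc₂ : ∀ a b x y z → a * (x * (b * (y * z))) ≡ a * b * (x * y * z)
    reassoc₂ = solve-∀

module Development {c ℓ} (F : CharZeroField c ℓ) where

  open Ops F
  open BinomialCoefficients
  open CommutativeRing commRing
    using (refl; sym; trans; setoid; reflexive; +-cong; +-congˡ; +-congʳ; *-cong; *-congˡ; *-congʳ;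
           +-assoc; *-assoc; +-comm; *-comm; +-identityˡ; +-identityʳ; *-identityˡ; *-identityʳ;
           zeroˡ; zeroʳ; distribˡ; distribʳ; -‿cong; -‿inverseʳ; ring)
  open import Algebra.Properties.Ring ring using (-‿distribˡ-*; -‿distribʳ-*; -‿involutive; -‿+-comm; -0#≈0#; -1*x≈-x)
  open import Algebra.Properties.CommutativeSemigroup (CommutativeRing.+-commutativeSemigroup commRing)
    using () renaming (interchange to +-interchange)
  open import Algebra.Properties.CommutativeSemigroup (CommutativeRing.*-commutativeSemigroup commRing)
    using () renaming (interchange to *-interchange)
  open import Relation.Binary.Reasoning.Setoid setoid

  fromℕ-+ : ∀ m n → fromℕ (m ℕ.+ n) ≈ fromℕ m + fromℕ n
  fromℕ-+ zero    n = sym (+-identityˡ _)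
  fromℕ-+ (suc m) n = trans (+-congˡ (fromℕ-+ m n)) (sym (+-assoc _ _ _))

  fromℕ-* : ∀ m n → fromℕ (m ℕ.* n) ≈ fromℕ m * fromℕ n
  fromℕ-* zero    n = sym (zeroˡ _)
  fromℕ-* (suc m) n = begin
    fromℕ (n ℕ.+ m ℕ.* n)               ≈⟨ fromℕ-+ n (m ℕ.* n) ⟩
    fromℕ n + fromℕ (m ℕ.* n)           ≈⟨ +-cong (sym (*-identityˡ _)) (fromℕ-* m n) ⟩
    1# * fromℕ n + fromℕ m * fromℕ n    ≈⟨ distribʳ _ _ _ ⟨
    (1# + fromℕ m) * fromℕ n            ∎

  fromℤ : ℤ → Carrier
  fromℤ (+ n)    = fromℕ n
  fromℤ -[1+ n ] = - fromℕ (suc n)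

  fromSign : Sign → Carrier
  fromSign Sign.+ = 1#
  fromSign Sign.- = - 1#

  fromSign-* : ∀ s t → fromSign (s Sign.* t) ≈ fromSign s * fromSign t
  fromSign-* Sign.+ t      = sym (*-identityˡ _)
  fromSign-* Sign.- Sign.+ = sym (*-identityʳ _)
  fromSign-* Sign.- Sign.- = begin
    1#              ≈⟨ -‿involutive 1# ⟨
    - - 1#          ≈⟨ -‿cong (*-identityʳ _) ⟨
    - (- 1# * 1#)   ≈⟨ -‿distribʳ-* _ _ ⟩
    - 1# * - 1#     ∎

  fromℤ-◃ : ∀ s n → fromℤ (s ℤ.◃ n) ≈ fromSign s * fromℕ n
  fromℤ-◃ s      zero    = sym (zeroʳ _)
  fromℤ-◃ Sign.+ (suc n) = sym (*-identityˡ _)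
  fromℤ-◃ Sign.- (suc n) = trans (-‿cong (sym (*-identityˡ _))) (-‿distribˡ-* 1# _)

  fromℤ-sign*abs : ∀ i → fromℤ i ≈ fromSign (ℤ.sign i) * fromℕ ℤ.∣ i ∣
  fromℤ-sign*abs i = trans (reflexive (≡.cong fromℤ (≡.sym (ℤₚ.◃-inverse i)))) (fromℤ-◃ (ℤ.sign i) ℤ.∣ i ∣)

  fromℤ-⊖ : ∀ m n → fromℤ (m ⊖ n) ≈ fromℕ m - fromℕ n
  fromℤ-⊖ m       zero    = trans (sym (+-identityʳ _)) (+-congˡ (sym -0#≈0#))
  fromℤ-⊖ zero    (suc n) = sym (+-identityˡ _)
  fromℤ-⊖ (suc m) (suc n) = begin
    fromℤ (suc m ⊖ suc n)           ≡⟨ ≡.cong fromℤ (ℤₚ.[1+m]⊖[1+n]≡m⊖n m n) ⟩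
    fromℤ (m ⊖ n)                   ≈⟨ fromℤ-⊖ m n ⟩
    fromℕ m - fromℕ n               ≈⟨ shift (fromℕ m) (fromℕ n) ⟩
    fromℕ (suc m) - fromℕ (suc n)   ∎
    where
    shift : ∀ a b → a - b ≈ (1# + a) - (1# + b)
    shift a b = begin
      a - b                   ≈⟨ +-identityˡ _ ⟨
      0# + (a - b)            ≈⟨ +-congʳ (-‿inverseʳ 1#) ⟨
      (1# - 1#) + (a - b)     ≈⟨ +-assoc _ _ _ ⟩
      1# + (- 1# + (a - b))   ≈⟨ +-congˡ (+-assoc _ _ _) ⟨
      1# + ((- 1# + a) - b)   ≈⟨ +-congˡ (+-congʳ (+-comm _ _)) ⟩
      1# + ((a - 1#) - b)     ≈⟨ +-congˡ (+-assoc _ _ _) ⟩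
      1# + (a + (- 1# - b))   ≈⟨ +-assoc _ _ _ ⟨
      (1# + a) + (- 1# - b)   ≈⟨ +-congˡ (-‿+-comm _ _) ⟩
      (1# + a) - (1# + b)     ∎

  fromℤ-+ : ∀ i j → fromℤ (i ℤ.+ j) ≈ fromℤ i + fromℤ j
  fromℤ-+ -[1+ m ] -[1+ n ] = begin
    - fromℕ (suc (suc (m ℕ.+ n)))       ≡⟨ ≡.cong (λ k → - fromℕ (suc k)) (ℕₚ.+-suc m n) ⟨
    - fromℕ (suc m ℕ.+ suc n)           ≈⟨ -‿cong (fromℕ-+ (suc m) (suc n)) ⟩
    - (fromℕ (suc m) + fromℕ (suc n))   ≈⟨ -‿+-comm _ _ ⟨
    - fromℕ (suc m) - fromℕ (suc n)     ∎
  fromℤ-+ -[1+ m ] (+ n)    = trans (fromℤ-⊖ n (suc m)) (+-comm _ _)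
  fromℤ-+ (+ m)    -[1+ n ] = fromℤ-⊖ m (suc n)
  fromℤ-+ (+ m)    (+ n)    = fromℕ-+ m n

  fromℤ-* : ∀ i j → fromℤ (i ℤ.* j) ≈ fromℤ i * fromℤ j
  fromℤ-* i j = begin
    fromℤ ((ℤ.sign i Sign.* ℤ.sign j) ℤ.◃ (ℤ.∣ i ∣ ℕ.* ℤ.∣ j ∣))
      ≈⟨ fromℤ-◃ (ℤ.sign i Sign.* ℤ.sign j) (ℤ.∣ i ∣ ℕ.* ℤ.∣ j ∣) ⟩
    fromSign (ℤ.sign i Sign.* ℤ.sign j) * fromℕ (ℤ.∣ i ∣ ℕ.* ℤ.∣ j ∣)
      ≈⟨ *-cong (fromSign-* (ℤ.sign i) (ℤ.sign j)) (fromℕ-* ℤ.∣ i ∣ ℤ.∣ j ∣) ⟩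
    (fromSign (ℤ.sign i) * fromSign (ℤ.sign j)) * (fromℕ ℤ.∣ i ∣ * fromℕ ℤ.∣ j ∣)
      ≈⟨ *-interchange _ _ _ _ ⟩
    (fromSign (ℤ.sign i) * fromℕ ℤ.∣ i ∣) * (fromSign (ℤ.sign j) * fromℕ ℤ.∣ j ∣)
      ≈⟨ *-cong (fromℤ-sign*abs i) (fromℤ-sign*abs j) ⟨
    fromℤ i * fromℤ j ∎

  fromℤ-neg : ∀ i → fromℤ (ℤ.- i) ≈ - fromℤ i
  fromℤ-neg -[1+ n ]    = sym (-‿involutive _)
  fromℤ-neg (+ zero)    = sym -0#≈0#
  fromℤ-neg (+ suc n)   = refl

  -- Equal to fromℤ, but sends + 1 to 1# on the nose, so that the solver's constant con (+ 1) is 1# itself.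
  fromℤ₁ : ℤ → Carrier
  fromℤ₁ (+ 1)    = 1#
  fromℤ₁ i        = fromℤ i

  fromℤ₁≈fromℤ : ∀ i → fromℤ₁ i ≈ fromℤ i
  fromℤ₁≈fromℤ (+ 0)          = refl
  fromℤ₁≈fromℤ (+ 1)          = sym (+-identityʳ 1#)
  fromℤ₁≈fromℤ (+ suc (suc n)) = refl
  fromℤ₁≈fromℤ -[1+ n ]       = refl

  ℤ-rawRing : RawRing _ _
  ℤ-rawRing = record { Carrier = ℤ ; _≈_ = _≡_ ; _+_ = ℤ._+_ ; _*_ = ℤ._*_ ; -_ = ℤ.-_ ; 0# = + 0 ; 1# = + 1 }

  fromℤ₁-homomorphism : ℤ-rawRing -Raw-AlmostCommutative⟶ fromCommutativeRing commRing
  fromℤ₁-homomorphism = record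
    { ⟦_⟧    = fromℤ₁
    ; +-homo = λ i j → trans (fromℤ₁≈fromℤ (i ℤ.+ j)) (trans (fromℤ-+ i j) (sym (+-cong (fromℤ₁≈fromℤ i) (fromℤ₁≈fromℤ j))))
    ; *-homo = λ i j → trans (fromℤ₁≈fromℤ (i ℤ.* j)) (trans (fromℤ-* i j) (sym (*-cong (fromℤ₁≈fromℤ i) (fromℤ₁≈fromℤ j))))
    ; -‿homo = λ i → trans (fromℤ₁≈fromℤ (ℤ.- i)) (trans (fromℤ-neg i) (sym (-‿cong (fromℤ₁≈fromℤ i))))
    ; 0-homo = refl
    ; 1-homo = refl
    }

  ℤ-weaklyDecidable : ∀ i j → Maybe (fromℤ₁ i ≈ fromℤ₁ j)
  ℤ-weaklyDecidable i j with i ℤ.≟ j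
  ... | yes i≡j = just (reflexive (≡.cong fromℤ₁ i≡j))
  ... | no _    = nothing

  open Algebra.Solver.Ring ℤ-rawRing (fromCommutativeRing commRing) fromℤ₁-homomorphism ℤ-weaklyDecidable
    using (solve; _:+_; _:*_; _:-_; :-_; con; _:=_)

  Invertible : Carrier → Set ℓ
  Invertible a = a * a ⁻¹ ≈ 1#

  1≉0 : ¬ (1# ≈ 0#)
  1≉0 1≈0 = charZero 0 (trans (+-identityʳ 1#) 1≈0)

  invertible : ∀ {a} b → a * b ≈ 1# → Invertible a
  invertible {a} b ab≈1 = inverseʳ a λ a≈0 → 1≉0 (trans (sym ab≈1) (trans (*-congʳ a≈0) (zeroˡ b)))

  ⁻¹-unique : ∀ {a} b → a * b ≈ 1# → a ⁻¹ ≈ b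
  ⁻¹-unique {a} b ab≈1 = begin
    a ⁻¹              ≈⟨ *-identityʳ _ ⟨
    a ⁻¹ * 1#         ≈⟨ *-congˡ ab≈1 ⟨
    a ⁻¹ * (a * b)    ≈⟨ *-assoc _ _ _ ⟨
    (a ⁻¹ * a) * b    ≈⟨ *-congʳ (trans (*-comm _ _) (invertible b ab≈1)) ⟩
    1# * b            ≈⟨ *-identityˡ b ⟩
    b                 ∎

  Invertible-resp-≈ : ∀ {a b} → a ≈ b → Invertible a → Invertible b
  Invertible-resp-≈ {a} a≈b inv-a = invertible (a ⁻¹) (trans (*-congʳ (sym a≈b)) inv-a)

  ⁻¹-cong : ∀ {a b} → Invertible a → a ≈ b → a ⁻¹ ≈ b ⁻¹
  ⁻¹-cong {a} inv-a a≈b = sym (⁻¹-unique (a ⁻¹) (trans (*-congʳ (sym a≈b)) inv-a))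

  *-⁻¹-inverse : ∀ {a b} → Invertible a → Invertible b → (a * b) * (a ⁻¹ * b ⁻¹) ≈ 1#
  *-⁻¹-inverse inv-a inv-b = trans (*-interchange _ _ _ _) (trans (*-cong inv-a inv-b) (*-identityʳ 1#))

  Invertible-* : ∀ {a b} → Invertible a → Invertible b → Invertible (a * b)
  Invertible-* inv-a inv-b = invertible _ (*-⁻¹-inverse inv-a inv-b)

  ⁻¹-distrib-* : ∀ {a b} → Invertible a → Invertible b → (a * b) ⁻¹ ≈ a ⁻¹ * b ⁻¹
  ⁻¹-distrib-* inv-a inv-b = ⁻¹-unique _ (*-⁻¹-inverse inv-a inv-b)

  Invertible-⁻¹ : ∀ {a} → Invertible a → Invertible (a ⁻¹)
  Invertible-⁻¹ {a} inv-a = invertible a (trans (*-comm _ _) inv-a)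

  Invertible-1 : Invertible 1#
  Invertible-1 = invertible 1# (*-identityˡ 1#)

  Invertible-fromℕ-suc : ∀ n → Invertible (fromℕ (suc n))
  Invertible-fromℕ-suc n = inverseʳ _ (charZero n)

  Invertible-fromℕ-! : ∀ n → Invertible (fromℕ (n ℕ.!))
  Invertible-fromℕ-! n with n ℕ.! | ℕₚ.1≤n! n
  ... | suc k | _ = Invertible-fromℕ-suc k

  prodFin-cong : ∀ n {f g : Fin n → Carrier} → (∀ i → f i ≈ g i) → prodFin n f ≈ prodFin n g
  prodFin-cong zero    f≈g = refl
  prodFin-cong (suc n) f≈g = *-cong (f≈g zero) (prodFin-cong n (f≈g ∘ suc))

  Invertible-prodFin : ∀ n (f : Fin n → Carrier) → (∀ i → Invertible (f i)) → Invertible (prodFin n f)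
  Invertible-prodFin zero    f inv = Invertible-1
  Invertible-prodFin (suc n) f inv = Invertible-* (inv zero) (Invertible-prodFin n (f ∘ suc) (inv ∘ suc))

  ⁻¹-prodFin : ∀ n (f : Fin n → Carrier) → (∀ i → Invertible (f i)) → prodFin n f ⁻¹ ≈ prodFin n (λ i → f i ⁻¹)
  ⁻¹-prodFin zero    f inv = ⁻¹-unique 1# (*-identityˡ 1#)
  ⁻¹-prodFin (suc n) f inv = trans (⁻¹-distrib-* (inv zero) (Invertible-prodFin n (f ∘ suc) (inv ∘ suc)))
                                   (*-congˡ (⁻¹-prodFin n (f ∘ suc) (inv ∘ suc)))

  Invertible-fromℕ+ : ∀ {τ} → (∀ m → ¬ (τ ≈ - fromℕ m)) → ∀ m → Invertible (fromℕ m + τ)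
  Invertible-fromℕ+ {τ} τ≉-m m = inverseʳ _ λ m+τ≈0 → τ≉-m m (begin
    τ                         ≈⟨ cancel (fromℕ m) τ ⟩
    - fromℕ m + (fromℕ m + τ) ≈⟨ +-congˡ m+τ≈0 ⟩
    - fromℕ m + 0#            ≈⟨ +-identityʳ _ ⟩
    - fromℕ m                 ∎)
    where
    cancel : ∀ a b → b ≈ - a + (a + b)
    cancel = solve 2 (λ a b → b := :- a :+ (a :+ b)) refl

  -- Opaque, so that goals about sumTo n f do not unfold and Agda can infer the summand f.
  opaque
    sumTo : ℕ → (ℕ → Carrier) → Carrier
    sumTo zero    f = 0#
    sumTo (suc n) f = f 0 + sumTo n (f ∘ suc)

    syntax sumTo n (λ i → f) = Σ[ i < n ] f

    Σ-suc : ∀ n (f : ℕ → Carrier) → sumTo (suc n) f ≈ f 0 + sumTo n (f ∘ suc)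
    Σ-suc n f = refl

    Σ-one : ∀ (f : ℕ → Carrier) → sumTo 1 f ≈ f 0
    Σ-one f = +-identityʳ _

    Σ-cong-< : ∀ n {f g : ℕ → Carrier} → (∀ i → i < n → f i ≈ g i) → sumTo n f ≈ sumTo n g
    Σ-cong-< zero    f≈g = refl
    Σ-cong-< (suc n) f≈g = +-cong (f≈g 0 (s≤s z≤n)) (Σ-cong-< n (λ i i<n → f≈g (suc i) (s≤s i<n)))

    Σ-cong : ∀ n {f g : ℕ → Carrier} → (∀ i → f i ≈ g i) → sumTo n f ≈ sumTo n g
    Σ-cong n f≈g = Σ-cong-< n (λ i _ → f≈g i)

    Σ-zero : ∀ n (f : ℕ → Carrier) → (∀ i → i < n → f i ≈ 0#) → sumTo n f ≈ 0#
    Σ-zero zero    f f≈0 = refl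
    Σ-zero (suc n) f f≈0 = trans (+-cong (f≈0 0 (s≤s z≤n)) (Σ-zero n (f ∘ suc) (λ i i<n → f≈0 (suc i) (s≤s i<n)))) (+-identityʳ 0#)

    Σ-+ : ∀ n (f g : ℕ → Carrier) → sumTo n (λ i → f i + g i) ≈ sumTo n f + sumTo n g
    Σ-+ zero    f g = sym (+-identityʳ 0#)
    Σ-+ (suc n) f g = trans (+-congˡ (Σ-+ n (f ∘ suc) (g ∘ suc))) (+-interchange _ _ _ _)

    Σ-*ˡ : ∀ n w (f : ℕ → Carrier) → sumTo n (λ i → w * f i) ≈ w * sumTo n f
    Σ-*ˡ zero    w f = sym (zeroʳ w)
    Σ-*ˡ (suc n) w f = trans (+-congˡ (Σ-*ˡ n w (f ∘ suc))) (sym (distribˡ _ _ _))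

    Σ-comm : ∀ m n (g : ℕ → ℕ → Carrier) → Σ[ i < m ] sumTo n (g i) ≈ Σ[ j < n ] Σ[ i < m ] g i j
    Σ-comm zero    n g = sym (Σ-zero n _ (λ _ _ → refl))
    Σ-comm (suc m) n g = begin
      sumTo n (g 0) + Σ[ i < m ] sumTo n (g (suc i))      ≈⟨ +-congˡ (Σ-comm m n (g ∘ suc)) ⟩
      sumTo n (g 0) + Σ[ j < n ] Σ[ i < m ] g (suc i) j   ≈⟨ Σ-+ n (g 0) _ ⟨
      Σ[ j < n ] Σ[ i < suc m ] g i j                     ∎

    Σ-split : ∀ m n (f : ℕ → Carrier) → sumTo (m ℕ.+ n) f ≈ sumTo m f + Σ[ i < n ] f (m ℕ.+ i)
    Σ-split zero    n f = sym (+-identityˡ _)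
    Σ-split (suc m) n f = trans (+-congˡ (Σ-split m n (f ∘ suc))) (sym (+-assoc _ _ _))

    Σ-extend : ∀ {m n} (f : ℕ → Carrier) → m ≤ n → (∀ i → m ≤ i → f i ≈ 0#) → sumTo m f ≈ sumTo n f
    Σ-extend {m} {n} f m≤n f≈0 = begin
      sumTo m f                                       ≈⟨ +-identityʳ _ ⟨
      sumTo m f + 0#                                  ≈⟨ +-congˡ (Σ-zero (n ℕ.∸ m) _ (λ i _ → f≈0 (m ℕ.+ i) (ℕₚ.m≤m+n m i))) ⟨
      sumTo m f + Σ[ i < n ℕ.∸ m ] f (m ℕ.+ i)        ≈⟨ Σ-split m (n ℕ.∸ m) f ⟨
      sumTo (m ℕ.+ (n ℕ.∸ m)) f                       ≡⟨ ≡.cong (λ k → sumTo k f) (ℕₚ.m+[n∸m]≡n m≤n) ⟩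
      sumTo n f                                       ∎

    Σ-drop-< : ∀ m n (f : ℕ → Carrier) → (∀ i → i < m → f i ≈ 0#) → sumTo (m ℕ.+ n) f ≈ Σ[ i < n ] f (m ℕ.+ i)
    Σ-drop-< m n f f≈0 = trans (Σ-split m n f) (trans (+-congʳ (Σ-zero m f f≈0)) (+-identityˡ _))

    sumL-applyUpTo : ∀ {a} {A : Set a} n (g : ℕ → A) (f : A → Carrier) → sumL (map f (applyUpTo g n)) ≈ sumTo n (f ∘ g)
    sumL-applyUpTo zero    g f = refl
    sumL-applyUpTo (suc n) g f = +-congˡ (sumL-applyUpTo n (g ∘ suc) f)

  sumL-cong : ∀ {a} {A : Set a} (xs : List A) {f g : A → Carrier} → (∀ x → f x ≈ g x) → sumL (map f xs) ≈ sumL (map g xs)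
  sumL-cong []       f≈g = refl
  sumL-cong (x ∷ xs) f≈g = +-cong (f≈g x) (sumL-cong xs f≈g)

  sumL-cong-All : ∀ {a} {A : Set a} {xs : List A} {f g : A → Carrier} → All (λ x → f x ≈ g x) xs → sumL (map f xs) ≈ sumL (map g xs)
  sumL-cong-All []            = refl
  sumL-cong-All (fx≈gx ∷ f≈g) = +-cong fx≈gx (sumL-cong-All f≈g)

  sumL-+ : ∀ {a} {A : Set a} (xs : List A) (f g : A → Carrier) → sumL (map (λ x → f x + g x) xs) ≈ sumL (map f xs) + sumL (map g xs)
  sumL-+ []       f g = sym (+-identityʳ 0#)
  sumL-+ (x ∷ xs) f g = trans (+-congˡ (sumL-+ xs f g)) (+-interchange _ _ _ _)

  sumL-*ˡ : ∀ {a} {A : Set a} (xs : List A) w (f : A → Carrier) → sumL (map (λ x → w * f x) xs) ≈ w * sumL (map f xs)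
  sumL-*ˡ []       w f = sym (zeroʳ w)
  sumL-*ˡ (x ∷ xs) w f = trans (+-congˡ (sumL-*ˡ xs w f)) (sym (distribˡ _ _ _))

  sumL-++ : (xs ys : List Carrier) → sumL (xs ++ ys) ≈ sumL xs + sumL ys
  sumL-++ []       ys = sym (+-identityˡ _)
  sumL-++ (x ∷ xs) ys = trans (+-congˡ (sumL-++ xs ys)) (sym (+-assoc _ _ _))

  sumL-concatMap : ∀ {a b} {A : Set a} {B : Set b} (xs : List A) (g : A → List B) (f : B → Carrier) →
                   sumL (map f (concatMap g xs)) ≈ sumL (map (λ x → sumL (map f (g x))) xs)
  sumL-concatMap []       g f = refl
  sumL-concatMap (x ∷ xs) g f = begin
    sumL (map f (g x ++ concatMap g xs))              ≡⟨ ≡.cong sumL (List.map-++ f (g x) (concatMap g xs)) ⟩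
    sumL (map f (g x) ++ map f (concatMap g xs))      ≈⟨ sumL-++ (map f (g x)) _ ⟩
    sumL (map f (g x)) + sumL (map f (concatMap g xs)) ≈⟨ +-congˡ (sumL-concatMap xs g f) ⟩
    sumL (map f (g x)) + sumL (map (λ y → sumL (map f (g y))) xs) ∎

  sumL-map : ∀ {a b} {A : Set a} {B : Set b} (xs : List A) (g : A → B) (f : B → Carrier) →
             sumL (map f (map g xs)) ≈ sumL (map (f ∘ g) xs)
  sumL-map xs g f = reflexive (≡.cong sumL (≡.sym (List.map-∘ xs)))

  -- Binomial sums

  choose : ℕ → ℕ → Carrier
  choose n k = fromℕ (n C k)

  sgn : ℕ → Carrier
  sgn = pow (- 1#)

  choose-> : ∀ {n k} → n < k → choose n k ≈ 0#
  choose-> n<k = reflexive (≡.cong fromℕ (k>n⇒nCk≡0 n<k))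

  choose-pascal : ∀ n k → choose (suc n) (suc k) ≈ choose n k + choose n (suc k)
  choose-pascal n k = trans (reflexive (≡.cong fromℕ (≡.sym (nCk+nC[k+1]≡[n+1]C[k+1] n k))))
                            (fromℕ-+ (n C k) (n C suc k))

  choose-n-0 : ∀ n → choose n 0 ≈ 1#
  choose-n-0 n = +-identityʳ 1#

  sgn-suc : ∀ j → sgn (suc j) ≈ - sgn j
  sgn-suc j = trans (sym (-‿distribˡ-* 1# (sgn j))) (-‿cong (*-identityˡ _))

  sgn-+ : ∀ i j → sgn (i ℕ.+ j) ≈ sgn i * sgn j
  sgn-+ zero    j = sym (*-identityˡ _)
  sgn-+ (suc i) j = trans (*-congˡ (sgn-+ i j)) (sym (*-assoc _ _ _))

  Σ-pascal : ∀ K (u : ℕ → Carrier) →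
    Σ[ j < suc (suc K) ] (choose (suc K) j * u j) ≈ Σ[ j < suc K ] (choose K j * u j) + Σ[ j < suc K ] (choose K j * u (suc j))
  Σ-pascal K u = begin
    Σ[ j < suc (suc K) ] (choose (suc K) j * u j)
      ≈⟨ Σ-suc (suc K) (λ j → choose (suc K) j * u j) ⟩
    choose (suc K) 0 * u 0 + Σ[ j < suc K ] (choose (suc K) (suc j) * u (suc j))
      ≈⟨ +-congˡ (Σ-cong (suc K) (λ j → trans (*-congʳ (choose-pascal K j)) (distribʳ (u (suc j)) _ _))) ⟩
    choose K 0 * u 0 + Σ[ j < suc K ] (choose K j * u (suc j) + choose K (suc j) * u (suc j))
      ≈⟨ +-congˡ (Σ-+ (suc K) (λ j → choose K j * u (suc j)) (λ j → choose K (suc j) * u (suc j))) ⟩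
    choose K 0 * u 0 + (Σ[ j < suc K ] (choose K j * u (suc j)) + Σ[ j < suc K ] (choose K (suc j) * u (suc j)))
      ≈⟨ +-congˡ (+-congˡ (Σ-extend _ (ℕₚ.n≤1+n K) vanish)) ⟨
    choose K 0 * u 0 + (Σ[ j < suc K ] (choose K j * u (suc j)) + Σ[ j < K ] (choose K (suc j) * u (suc j)))
      ≈⟨ rearrange _ _ _ ⟩
    (choose K 0 * u 0 + Σ[ j < K ] (choose K (suc j) * u (suc j))) + Σ[ j < suc K ] (choose K j * u (suc j))
      ≈⟨ +-congʳ (Σ-suc K (λ j → choose K j * u j)) ⟨
    Σ[ j < suc K ] (choose K j * u j) + Σ[ j < suc K ] (choose K j * u (suc j)) ∎
    where
    vanish : ∀ j → K ≤ j → choose K (suc j) * u (suc j) ≈ 0#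
    vanish j K≤j = trans (*-congʳ (choose-> (s≤s K≤j))) (zeroˡ _)
    rearrange : ∀ a b c → a + (b + c) ≈ (a + c) + b
    rearrange = solve 3 (λ a b c → a :+ (b :+ c) := (a :+ c) :+ b) refl

  binomialTheorem : ∀ N x → Σ[ j < suc N ] (choose N j * (sgn j * pow x j)) ≈ pow (1# - x) N
  binomialTheorem zero    x = trans (Σ-one _)  (trans (*-cong (choose-n-0 0) (*-identityʳ 1#)) (*-identityʳ 1#))
  binomialTheorem (suc N) x = begin
    Σ[ j < suc (suc N) ] (choose (suc N) j * (sgn j * pow x j))
      ≈⟨ Σ-pascal N (λ j → sgn j * pow x j) ⟩
    Σ[ j < suc N ] (choose N j * (sgn j * pow x j)) + Σ[ j < suc N ] (choose N j * (sgn (suc j) * pow x (suc j)))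
      ≈⟨ +-congˡ (Σ-cong (suc N) (λ j → trans (*-congˡ (*-congʳ (sgn-suc j))) (pull (choose N j) (sgn j) (pow x j) x))) ⟩
    Σ[ j < suc N ] (choose N j * (sgn j * pow x j)) + Σ[ j < suc N ] (- x * (choose N j * (sgn j * pow x j)))
      ≈⟨ +-congˡ (Σ-*ˡ (suc N) (- x) (λ j → choose N j * (sgn j * pow x j))) ⟩
    Σ[ j < suc N ] (choose N j * (sgn j * pow x j)) + - x * Σ[ j < suc N ] (choose N j * (sgn j * pow x j))
      ≈⟨ +-cong (binomialTheorem N x) (*-congˡ (binomialTheorem N x)) ⟩
    pow (1# - x) N + - x * pow (1# - x) N
      ≈⟨ collect (pow (1# - x) N) x ⟩
    (1# - x) * pow (1# - x) N ∎
    where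
    pull : ∀ c s p x → c * (- s * (x * p)) ≈ - x * (c * (s * p))
    pull = solve 4 (λ c s p x → c :* (:- s :* (x :* p)) := :- x :* (c :* (s :* p))) refl
    collect : ∀ p x → p + - x * p ≈ (1# - x) * p
    collect = solve 2 (λ p x → p :+ :- x :* p := (con (+ 1) :- x) :* p) refl

  Pascal : (ℕ → ℕ → Carrier) → Set ℓ
  Pascal h = ∀ d b → h d b ≈ h (suc d) b + h d (suc b)

  module _ (x : Carrier) (h : ℕ → ℕ → Carrier) where

    alternatingSum : ℕ → ℕ → ℕ → Carrier
    alternatingSum K d b = Σ[ j < suc K ] (choose K j * (sgn j * (pow x j * h (d ℕ.+ j) b)))

    binomialSum : ℕ → ℕ → ℕ → Carrier
    binomialSum K d b = Σ[ a < suc K ] (choose K a * (pow (1# - x) (K ℕ.∸ a) * h (d ℕ.+ (K ℕ.∸ a)) (b ℕ.+ a)))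

    alternatingSum-pascal : Pascal h → ∀ K d b → alternatingSum K d b ≈ alternatingSum K (suc d) b + alternatingSum K d (suc b)
    alternatingSum-pascal h-pascal K d b = trans (Σ-cong (suc K) (λ j → trans (*-congˡ (*-congˡ (*-congˡ (h-pascal (d ℕ.+ j) b)))) (split _ _ _ _ _)))
                                        (Σ-+ (suc K) (λ j → choose K j * (sgn j * (pow x j * h (suc (d ℕ.+ j)) b)))
                                                     (λ j → choose K j * (sgn j * (pow x j * h (d ℕ.+ j) (suc b)))))
      where
      split : ∀ a b p u v → a * (b * (p * (u + v))) ≈ a * (b * (p * u)) + a * (b * (p * v))
      split = solve 5 (λ a b p u v → a :* (b :* (p :* (u :+ v))) := a :* (b :* (p :* u)) :+ a :* (b :* (p :* v))) refl

    alternatingSum-suc : ∀ K d b → alternatingSum (suc K) d b ≈ alternatingSum K d b + - x * alternatingSum K (suc d) b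
    alternatingSum-suc K d b = begin
      alternatingSum (suc K) d b
        ≈⟨ Σ-pascal K (λ j → sgn j * (pow x j * h (d ℕ.+ j) b)) ⟩
      alternatingSum K d b + Σ[ j < suc K ] (choose K j * (sgn (suc j) * (pow x (suc j) * h (d ℕ.+ suc j) b)))
        ≈⟨ +-congˡ (Σ-cong (suc K) (λ j → trans (*-congˡ (*-cong (sgn-suc j) (*-congˡ (reflexive (≡.cong (λ e → h e b) (ℕₚ.+-suc d j))))))
                                                (pull (choose K j) (sgn j) (pow x j) x (h (suc d ℕ.+ j) b)))) ⟩
      alternatingSum K d b + Σ[ j < suc K ] (- x * (choose K j * (sgn j * (pow x j * h (suc d ℕ.+ j) b))))
        ≈⟨ +-congˡ (Σ-*ˡ (suc K) (- x) (λ j → choose K j * (sgn j * (pow x j * h (suc d ℕ.+ j) b)))) ⟩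
      alternatingSum K d b + - x * alternatingSum K (suc d) b ∎
      where
      pull : ∀ c s p x v → c * (- s * ((x * p) * v)) ≈ - x * (c * (s * (p * v)))
      pull = solve 5 (λ c s p x v → c :* (:- s :* ((x :* p) :* v)) := :- x :* (c :* (s :* (p :* v)))) refl

    binomialSum-suc : ∀ K d b → binomialSum (suc K) d b ≈ (1# - x) * binomialSum K (suc d) b + binomialSum K d (suc b)
    binomialSum-suc K d b = begin
      binomialSum (suc K) d b
        ≈⟨ Σ-pascal K (λ a → pow (1# - x) (suc K ℕ.∸ a) * h (d ℕ.+ (suc K ℕ.∸ a)) (b ℕ.+ a)) ⟩
      Σ[ a < suc K ] (choose K a * (pow (1# - x) (suc K ℕ.∸ a) * h (d ℕ.+ (suc K ℕ.∸ a)) (b ℕ.+ a)))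
        + Σ[ a < suc K ] (choose K a * (pow (1# - x) (K ℕ.∸ a) * h (d ℕ.+ (K ℕ.∸ a)) (b ℕ.+ suc a)))
        ≈⟨ +-cong (trans (Σ-cong-< (suc K) (λ a a<1+K → pull-1-x a (ℕₚ.≤-pred a<1+K)))
                         (Σ-*ˡ (suc K) (1# - x) (λ a → choose K a * (pow (1# - x) (K ℕ.∸ a) * h (suc d ℕ.+ (K ℕ.∸ a)) (b ℕ.+ a)))))
                  (Σ-cong (suc K) (λ a → *-congˡ (*-congˡ (reflexive (≡.cong (h (d ℕ.+ (K ℕ.∸ a))) (ℕₚ.+-suc b a)))))) ⟩
      (1# - x) * binomialSum K (suc d) b + binomialSum K d (suc b) ∎
      where
      pull : ∀ c y p v → c * ((y * p) * v) ≈ y * (c * (p * v))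
      pull = solve 4 (λ c y p v → c :* ((y :* p) :* v) := y :* (c :* (p :* v))) refl
      pull-1-x : ∀ a → a ≤ K → choose K a * (pow (1# - x) (suc K ℕ.∸ a) * h (d ℕ.+ (suc K ℕ.∸ a)) (b ℕ.+ a))
                             ≈ (1# - x) * (choose K a * (pow (1# - x) (K ℕ.∸ a) * h (suc d ℕ.+ (K ℕ.∸ a)) (b ℕ.+ a)))
      pull-1-x a a≤K rewrite ℕₚ.+-∸-assoc 1 a≤K | ℕₚ.+-suc d (K ℕ.∸ a) = pull _ _ _ _

    -- Both sides satisfy the recursion of binomialSum-suc (the left one because h is Pascal).
    alternatingSum≈binomialSum : Pascal h → ∀ K d b → alternatingSum K d b ≈ binomialSum K d b
    alternatingSum≈binomialSum _ zero d b =
      trans (Σ-one _) (trans (*-congˡ (trans (*-identityˡ _) (*-congˡ (reflexive (≡.cong (h (d ℕ.+ 0)) (≡.sym (ℕₚ.+-identityʳ b))))))) (sym (Σ-one _)))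
    alternatingSum≈binomialSum h-pascal (suc K) d b = begin
      alternatingSum (suc K) d b
        ≈⟨ alternatingSum-suc K d b ⟩
      alternatingSum K d b + - x * alternatingSum K (suc d) b
        ≈⟨ +-congʳ (alternatingSum-pascal h-pascal K d b) ⟩
      (alternatingSum K (suc d) b + alternatingSum K d (suc b)) + - x * alternatingSum K (suc d) b
        ≈⟨ collect (alternatingSum K (suc d) b) (alternatingSum K d (suc b)) x ⟩
      (1# - x) * alternatingSum K (suc d) b + alternatingSum K d (suc b)
        ≈⟨ +-cong (*-congˡ (alternatingSum≈binomialSum h-pascal K (suc d) b)) (alternatingSum≈binomialSum h-pascal K d (suc b)) ⟩
      (1# - x) * binomialSum K (suc d) b + binomialSum K d (suc b)
        ≈⟨ binomialSum-suc K d b ⟨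
      binomialSum (suc K) d b ∎
      where
      collect : ∀ p q x → (p + q) + - x * p ≈ (1# - x) * p + q
      collect = solve 3 (λ p q x → (p :+ q) :+ :- x :* p := (con (+ 1) :- x) :* p :+ q) refl

  Σ-trinomialRevision : ∀ N (G : ℕ → ℕ → Carrier) →
    Σ[ j < suc N ] (choose N j * Σ[ a < suc j ] (choose j a * G a (j ℕ.∸ a)))
      ≈ Σ[ a < suc N ] (choose N a * Σ[ k < suc (N ℕ.∸ a) ] (choose (N ℕ.∸ a) k * G a k))
  Σ-trinomialRevision N G = begin
    Σ[ j < suc N ] (choose N j * Σ[ a < suc j ] (choose j a * G a (j ℕ.∸ a)))
      ≈⟨ Σ-cong-< (suc N) (λ j j<1+N → trans (*-congˡ (Σ-extend (λ a → choose j a * G a (j ℕ.∸ a)) j<1+N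
                                                           (λ a j<a → trans (*-congʳ (choose-> j<a)) (zeroˡ _))))
                                              (sym (Σ-*ˡ (suc N) (choose N j) (λ a → choose j a * G a (j ℕ.∸ a))))) ⟩
    Σ[ j < suc N ] Σ[ a < suc N ] T a j
      ≈⟨ Σ-comm (suc N) (suc N) (λ j a → T a j) ⟩
    Σ[ a < suc N ] Σ[ j < suc N ] T a j
      ≈⟨ Σ-cong-< (suc N) (λ a a<1+N → inner a (ℕₚ.≤-pred a<1+N)) ⟩
    Σ[ a < suc N ] (choose N a * Σ[ k < suc (N ℕ.∸ a) ] (choose (N ℕ.∸ a) k * G a k)) ∎
    where
    T : ℕ → ℕ → Carrier
    T a j = choose N j * (choose j a * G a (j ℕ.∸ a))
    revision : ∀ a k → a ≤ N → T a (a ℕ.+ k) ≈ choose N a * (choose (N ℕ.∸ a) k * G a k)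
    revision a k a≤N = begin
      choose N (a ℕ.+ k) * (choose (a ℕ.+ k) a * G a (a ℕ.+ k ℕ.∸ a))
        ≡⟨ ≡.cong (λ e → choose N (a ℕ.+ k) * (choose (a ℕ.+ k) a * G a e)) (ℕₚ.m+n∸m≡n a k) ⟩
      choose N (a ℕ.+ k) * (choose (a ℕ.+ k) a * G a k)
        ≈⟨ *-assoc _ _ _ ⟨
      (choose N (a ℕ.+ k) * choose (a ℕ.+ k) a) * G a k
        ≈⟨ *-congʳ (fromℕ-* (N C (a ℕ.+ k)) ((a ℕ.+ k) C a)) ⟨
      fromℕ ((N C (a ℕ.+ k)) ℕ.* ((a ℕ.+ k) C a)) * G a k
        ≡⟨ ≡.cong (λ e → fromℕ e * G a k) (nC[j+k]*[j+k]Cj≡nCj*[n∸j]Ck a k a≤N) ⟩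
      fromℕ ((N C a) ℕ.* ((N ℕ.∸ a) C k)) * G a k
        ≈⟨ *-congʳ (fromℕ-* (N C a) ((N ℕ.∸ a) C k)) ⟩
      (choose N a * choose (N ℕ.∸ a) k) * G a k
        ≈⟨ *-assoc _ _ _ ⟩
      choose N a * (choose (N ℕ.∸ a) k * G a k) ∎
    inner : ∀ a → a ≤ N → Σ[ j < suc N ] T a j ≈ choose N a * Σ[ k < suc (N ℕ.∸ a) ] (choose (N ℕ.∸ a) k * G a k)
    inner a a≤N = begin
      Σ[ j < suc N ] T a j
        ≡⟨ ≡.cong (λ e → sumTo e (T a)) (≡.sym (≡.trans (ℕₚ.+-suc a (N ℕ.∸ a)) (≡.cong suc (ℕₚ.m+[n∸m]≡n a≤N)))) ⟩
      sumTo (a ℕ.+ suc (N ℕ.∸ a)) (T a)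
        ≈⟨ Σ-drop-< a (suc (N ℕ.∸ a)) (T a) (λ j j<a → trans (*-congˡ (trans (*-congʳ (choose-> j<a)) (zeroˡ _))) (zeroʳ _)) ⟩
      Σ[ k < suc (N ℕ.∸ a) ] T a (a ℕ.+ k)
        ≈⟨ Σ-cong (suc (N ℕ.∸ a)) (λ k → revision a k a≤N) ⟩
      Σ[ k < suc (N ℕ.∸ a) ] (choose N a * (choose (N ℕ.∸ a) k * G a k))
        ≈⟨ Σ-*ˡ (suc (N ℕ.∸ a)) (choose N a) (λ k → choose (N ℕ.∸ a) k * G a k) ⟩
      choose N a * Σ[ k < suc (N ℕ.∸ a) ] (choose (N ℕ.∸ a) k * G a k) ∎

  -- Finite differences

  Extensional : ∀ {r} → ((Fin r → ℕ) → Carrier) → Set ℓ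
  Extensional {r} a = ∀ {m m′ : Fin r → ℕ} → (∀ i → m i ≡ m′ i) → a m ≈ a m′

  bump-cong : ∀ {r} (i : Fin r) {m m′ : Fin r → ℕ} → (∀ j → m j ≡ m′ j) → ∀ j → bump i m j ≡ bump i m′ j
  bump-cong i m≗m′ j with j ≟ i
  ... | yes _ = ≡.cong suc (m≗m′ j)
  ... | no  _ = m≗m′ j

  bump-zero-∷ : ∀ {r} z (m : Fin r → ℕ) j → bump zero (z ∷ᵛ m) j ≡ (suc z ∷ᵛ m) j
  bump-zero-∷ z m zero    = ≡.refl
  bump-zero-∷ z m (suc j) = ≡.refl

  bump-suc-∷ : ∀ {r} (i : Fin r) z (m : Fin r → ℕ) j → bump (suc i) (z ∷ᵛ m) j ≡ (z ∷ᵛ bump i m) j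
  bump-suc-∷ i z m zero = ≡.refl
  bump-suc-∷ i z m (suc j) with j ≟ i
  ... | yes _ = ≡.refl
  ... | no  _ = ≡.refl

  module _ {r : ℕ} where

    private
      Array = (Fin r → ℕ) → Carrier

    Δ-cong : ∀ i {a b : Array} → (∀ m → a m ≈ b m) → ∀ m → Δ i a m ≈ Δ i b m
    Δ-cong i a≈b m = +-cong (a≈b m) (-‿cong (a≈b (bump i m)))

    Δ-extensional : ∀ i {a : Array} → Extensional a → Extensional (Δ i a)
    Δ-extensional i ext m≗m′ = +-cong (ext m≗m′) (-‿cong (ext (bump-cong i m≗m′)))

    iterΔ-cong : ∀ k i {a b : Array} → (∀ m → a m ≈ b m) → ∀ m → iter k (Δ i) a m ≈ iter k (Δ i) b m
    iterΔ-cong zero    i a≈b = a≈b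
    iterΔ-cong (suc k) i a≈b = Δ-cong i (iterΔ-cong k i a≈b)

    iterΔ-extensional : ∀ k i {a : Array} → Extensional a → Extensional (iter k (Δ i) a)
    iterΔ-extensional zero    i ext = ext
    iterΔ-extensional (suc k) i ext = Δ-extensional i (iterΔ-extensional k i ext)

    iterΔ-0 : ∀ k i m → iter k (Δ i) (λ (_ : Fin r → ℕ) → 0#) m ≈ 0#
    iterΔ-0 zero    i m = refl
    iterΔ-0 (suc k) i m = trans (Δ-cong i (iterΔ-0 k i) m) (-‿inverseʳ 0#)

    iterΔ-+ : ∀ k i (a b : Array) m → iter k (Δ i) (λ m → a m + b m) m ≈ iter k (Δ i) a m + iter k (Δ i) b m
    iterΔ-+ zero    i a b m = refl
    iterΔ-+ (suc k) i a b m = trans (Δ-cong i (iterΔ-+ k i a b) m) (distrib (iter k (Δ i) a m) (iter k (Δ i) b m) _ _)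
      where
      distrib : ∀ u v u′ v′ → (u + v) - (u′ + v′) ≈ (u - u′) + (v - v′)
      distrib = solve 4 (λ u v u′ v′ → (u :+ v) :- (u′ :+ v′) := (u :- u′) :+ (v :- v′)) refl

    iterΔ-*ˡ : ∀ k i w (a : Array) m → iter k (Δ i) (λ m → w * a m) m ≈ w * iter k (Δ i) a m
    iterΔ-*ˡ zero    i w a m = refl
    iterΔ-*ˡ (suc k) i w a m = trans (Δ-cong i (iterΔ-*ˡ k i w a) m) (distrib w (iter k (Δ i) a m) _)
      where
      distrib : ∀ w u u′ → w * u - w * u′ ≈ w * (u - u′)
      distrib = solve 3 (λ w u u′ → w :* u :- w :* u′ := w :* (u :- u′)) refl

    -- Δs f n applies Δ_{f j}^{n (f j)} for j = 0, 1, …, so that nabla a n = Δs id n a (0, …, 0).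
    Δs : ∀ {s} → (Fin s → Fin r) → (Fin r → ℕ) → Array → Array
    Δs f n = foldr (λ i g → iter (n i) (Δ i) ∘ g) id (tabulate f)

    Δs-cong : ∀ s (f : Fin s → Fin r) n {a b : Array} → (∀ m → a m ≈ b m) → ∀ m → Δs f n a m ≈ Δs f n b m
    Δs-cong zero    f n a≈b = a≈b
    Δs-cong (suc s) f n a≈b = iterΔ-cong (n (f zero)) (f zero) (Δs-cong s (f ∘ suc) n a≈b)

    Δs-extensional : ∀ s (f : Fin s → Fin r) n {a : Array} → Extensional a → Extensional (Δs f n a)
    Δs-extensional zero    f n ext = ext
    Δs-extensional (suc s) f n ext = iterΔ-extensional (n (f zero)) (f zero) (Δs-extensional s (f ∘ suc) n ext)

    Δs-linear : ∀ s (f : Fin s → Fin r) n {a} {A : Set a} (xs : List A) (w : A → Carrier) (g : A → Array) m →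
      Δs f n (λ m → sumL (map (λ e → w e * g e m) xs)) m ≈ sumL (map (λ e → w e * Δs f n (g e) m) xs)
    Δs-linear zero    f n xs       w g m = refl
    Δs-linear (suc s) f n []       w g m = trans (iterΔ-cong (n (f zero)) (f zero) (λ m → Δs-linear s (f ∘ suc) n [] w g m) m)
                                                 (iterΔ-0 (n (f zero)) (f zero) m)
    Δs-linear (suc s) f n (e ∷ xs) w g m = begin
      iter k (Δ i) (Δs (f ∘ suc) n (λ m → w e * g e m + sumL (map (λ e → w e * g e m) xs))) m
        ≈⟨ iterΔ-cong k i (λ m → Δs-linear s (f ∘ suc) n (e ∷ xs) w g m) m ⟩
      iter k (Δ i) (λ m → w e * Δs (f ∘ suc) n (g e) m + sumL (map (λ e → w e * Δs (f ∘ suc) n (g e) m) xs)) m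
        ≈⟨ iterΔ-+ k i _ _ m ⟩
      iter k (Δ i) (λ m → w e * Δs (f ∘ suc) n (g e) m) m + iter k (Δ i) (λ m → sumL (map (λ e → w e * Δs (f ∘ suc) n (g e) m) xs)) m
        ≈⟨ +-cong (iterΔ-*ˡ k i (w e) _ m) (trans (iterΔ-cong k i (λ m → sym (Δs-linear s (f ∘ suc) n xs w g m)) m)
                                                  (Δs-linear (suc s) f n xs w g m)) ⟩
      w e * Δs f n (g e) m + sumL (map (λ e → w e * Δs f n (g e) m) xs) ∎
      where
      i = f zero
      k = n i

  nabla-cong : ∀ r {a b : (Fin r → ℕ) → Carrier} → (∀ m → a m ≈ b m) → ∀ n → nabla a n ≈ nabla b n
  nabla-cong r a≈b n = Δs-cong r id n a≈b (λ _ → 0)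

  nabla-linear : ∀ r {a} {A : Set a} (xs : List A) (w : A → Carrier) (g : A → (Fin r → ℕ) → Carrier) n →
    nabla (λ m → sumL (map (λ e → w e * g e m) xs)) n ≈ sumL (map (λ e → w e * nabla (g e) n) xs)
  nabla-linear r xs w g n = Δs-linear r id n xs w g (λ _ → 0)

  iterΔ-suc-∷ : ∀ {r} k (i : Fin r) (a : (Fin (suc r) → ℕ) → Carrier) → Extensional a → ∀ j m →
    iter k (Δ (suc i)) a (j ∷ᵛ m) ≈ iter k (Δ i) (λ m′ → a (j ∷ᵛ m′)) m
  iterΔ-suc-∷ zero    i a ext j m = refl
  iterΔ-suc-∷ (suc k) i a ext j m =
    +-cong (iterΔ-suc-∷ k i a ext j m)
           (-‿cong (trans (iterΔ-extensional k (suc i) ext (bump-suc-∷ i j m)) (iterΔ-suc-∷ k i a ext j (bump i m))))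

  Δs-suc-∷ : ∀ {r} s (f : Fin s → Fin r) n (a : (Fin (suc r) → ℕ) → Carrier) → Extensional a → ∀ j m →
    Δs (suc ∘ f) n a (j ∷ᵛ m) ≈ Δs f (n ∘ suc) (λ m′ → a (j ∷ᵛ m′)) m
  Δs-suc-∷ zero    f n a ext j m = refl
  Δs-suc-∷ (suc s) f n a ext j m =
    trans (iterΔ-suc-∷ (n (suc (f zero))) (f zero) _ (Δs-extensional s (suc ∘ f ∘ suc) n ext) j m)
          (iterΔ-cong (n (suc (f zero))) (f zero) (Δs-suc-∷ s (f ∘ suc) n a ext j) m)

  iterΔ-zero-∷ : ∀ {r} k (a : (Fin (suc r) → ℕ) → Carrier) → Extensional a → ∀ z m →
    iter k (Δ zero) a (z ∷ᵛ m) ≈ Σ[ j < suc k ] (choose k j * (sgn j * a ((z ℕ.+ j) ∷ᵛ m)))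
  iterΔ-zero-∷ zero a ext z m = sym (begin
    Σ[ j < 1 ] (choose 0 j * (sgn j * a ((z ℕ.+ j) ∷ᵛ m)))  ≈⟨ Σ-one _ ⟩
    choose 0 0 * (1# * a ((z ℕ.+ 0) ∷ᵛ m))                 ≈⟨ *-cong (choose-n-0 0) (*-identityˡ _) ⟩
    1# * a ((z ℕ.+ 0) ∷ᵛ m)                                 ≈⟨ *-identityˡ _ ⟩
    a ((z ℕ.+ 0) ∷ᵛ m)                                      ≈⟨ ext (λ { zero → ℕₚ.+-identityʳ z ; (suc i) → ≡.refl }) ⟩
    a (z ∷ᵛ m)                                              ∎)
  iterΔ-zero-∷ (suc k) a ext z m = begin
    iter k (Δ zero) a (z ∷ᵛ m) - iter k (Δ zero) a (bump zero (z ∷ᵛ m))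
      ≈⟨ +-congˡ (-‿cong (iterΔ-extensional k zero ext (bump-zero-∷ z m))) ⟩
    iter k (Δ zero) a (z ∷ᵛ m) - iter k (Δ zero) a (suc z ∷ᵛ m)
      ≈⟨ +-cong (iterΔ-zero-∷ k a ext z m) (-‿cong (iterΔ-zero-∷ k a ext (suc z) m)) ⟩
    Σ[ j < suc k ] (choose k j * u j) - Σ[ j < suc k ] (choose k j * (sgn j * a ((suc z ℕ.+ j) ∷ᵛ m)))
      ≈⟨ +-congˡ (trans (Σ-*ˡ (suc k) (- 1#) (λ j → choose k j * (sgn j * a ((suc z ℕ.+ j) ∷ᵛ m)))) (-1*x≈-x _)) ⟨
    Σ[ j < suc k ] (choose k j * u j) + Σ[ j < suc k ] (- 1# * (choose k j * (sgn j * a ((suc z ℕ.+ j) ∷ᵛ m))))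
      ≈⟨ +-congˡ (Σ-cong (suc k) (λ j → trans (negate (choose k j) (sgn j) _)
                                               (*-congˡ (*-cong (sym (sgn-suc j)) (ext (λ { zero → ≡.sym (ℕₚ.+-suc z j) ; (suc i) → ≡.refl })))))) ⟩
    Σ[ j < suc k ] (choose k j * u j) + Σ[ j < suc k ] (choose k j * u (suc j))
      ≈⟨ Σ-pascal k u ⟨
    Σ[ j < suc (suc k) ] (choose (suc k) j * u j) ∎
    where
    u : ℕ → Carrier
    u j = sgn j * a ((z ℕ.+ j) ∷ᵛ m)
    negate : ∀ c s v → - 1# * (c * (s * v)) ≈ c * (- s * v)
    negate = solve 3 (λ c s v → :- con (+ 1) :* (c :* (s :* v)) := c :* (:- s :* v)) refl

  nabla-expandFirst : ∀ r (a : (Fin (suc r) → ℕ) → Carrier) → Extensional a → ∀ n →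
    nabla a n ≈ Σ[ j < suc (n zero) ] (choose (n zero) j * (sgn j * nabla (λ m → a (j ∷ᵛ m)) (n ∘ suc)))
  nabla-expandFirst r a ext n = begin
    iter (n zero) (Δ zero) b (λ _ → 0)
      ≈⟨ iterΔ-extensional (n zero) zero (Δs-extensional r suc n ext) (λ { zero → ≡.refl ; (suc i) → ≡.refl }) ⟩
    iter (n zero) (Δ zero) b (0 ∷ᵛ (λ _ → 0))
      ≈⟨ iterΔ-zero-∷ (n zero) b (Δs-extensional r suc n ext) 0 (λ _ → 0) ⟩
    Σ[ j < suc (n zero) ] (choose (n zero) j * (sgn j * b (j ∷ᵛ (λ _ → 0))))
      ≈⟨ Σ-cong (suc (n zero)) (λ j → *-congˡ (*-congˡ (Δs-suc-∷ r id n a ext j (λ _ → 0)))) ⟩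
    Σ[ j < suc (n zero) ] (choose (n zero) j * (sgn j * nabla (λ m → a (j ∷ᵛ m)) (n ∘ suc))) ∎
    where
    b = Δs suc n a

  -- The weights β

  falling-cong : ∀ {w w′} m → w ≈ w′ → falling w m ≈ falling w′ m
  falling-cong zero    w≈w′ = refl
  falling-cong (suc m) w≈w′ = *-cong (falling-cong m w≈w′) (+-congʳ w≈w′)

  Invertible-falling : ∀ w m → (∀ i → i < m → Invertible (w - fromℕ i)) → Invertible (falling w m)
  Invertible-falling w zero    inv = Invertible-1
  Invertible-falling w (suc m) inv = Invertible-* (Invertible-falling w m (λ i i<m → inv i (ℕₚ.m<n⇒m<1+n i<m))) (inv m (ℕₚ.n<1+n m))

  falling-*-shift : ∀ w d → falling w d * (w - fromℕ d) ≈ w * falling (w - 1#) d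
  falling-*-shift w zero    = solve 1 (λ w → con (+ 1) :* (w :- con (+ 0)) := w :* con (+ 1)) refl w
  falling-*-shift w (suc d) = begin
    (falling w d * (w - fromℕ d)) * (w - (1# + fromℕ d)) ≈⟨ *-congʳ (falling-*-shift w d) ⟩
    (w * falling (w - 1#) d) * (w - (1# + fromℕ d))      ≈⟨ reassoc w (falling (w - 1#) d) (fromℕ d) ⟩
    w * (falling (w - 1#) d * ((w - 1#) - fromℕ d))      ∎
    where
    reassoc : ∀ w f δ → (w * f) * (w - (1# + δ)) ≈ w * (f * ((w - 1#) - δ))
    reassoc = solve 3 (λ w f δ → (w :* f) :* (w :- (con (+ 1) :+ δ)) := w :* (f :* ((w :- con (+ 1)) :- δ))) refl

  ⁻¹≈⁻¹+⁻¹ : ∀ {a b c} → Invertible b → Invertible c → b * c ≈ a * (b + c) → a ⁻¹ ≈ b ⁻¹ + c ⁻¹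
  ⁻¹≈⁻¹+⁻¹ {a} {b} {c} inv-b inv-c bc≈a[b+c] = ⁻¹-unique _ (begin
    a * (b ⁻¹ + c ⁻¹)                           ≈⟨ *-congˡ (+-cong (trans (sym (*-identityʳ _)) (*-congˡ (sym inv-c)))
                                                                   (trans (sym (*-identityʳ _)) (*-congˡ (sym inv-b)))) ⟩
    a * (b ⁻¹ * (c * c ⁻¹) + c ⁻¹ * (b * b ⁻¹)) ≈⟨ expand a b c (b ⁻¹) (c ⁻¹) ⟩
    (a * (b + c)) * (b ⁻¹ * c ⁻¹)               ≈⟨ *-congʳ bc≈a[b+c] ⟨
    (b * c) * (b ⁻¹ * c ⁻¹)                     ≈⟨ *-⁻¹-inverse inv-b inv-c ⟩
    1#                                          ∎)
    where
    expand : ∀ a b c b′ c′ → a * (b′ * (c * c′) + c′ * (b * b′)) ≈ (a * (b + c)) * (b′ * c′)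
    expand = solve 5 (λ a b c b′ c′ → a :* (b′ :* (c :* c′) :+ c′ :* (b :* b′)) := (a :* (b :+ c)) :* (b′ :* c′)) refl

  module Beta {τ : Carrier} (τ≉-m : ∀ m → ¬ (τ ≈ - fromℕ m)) where

    βDen : Carrier → ℕ → Carrier
    βDen s d = binom (s + τ - 1#) d * (s + τ)

    -- For τ = 1, β d b = d! b! / (d + b + 1)!, a value of the Beta function.
    β : ℕ → ℕ → Carrier
    β d b = βDen (fromℕ (d ℕ.+ b)) d ⁻¹

    Invertible-βDen : ∀ s d → d ≤ s → Invertible (βDen (fromℕ s) d)
    Invertible-βDen s d d≤s =
      Invertible-* (Invertible-* (Invertible-falling _ d factor) (Invertible-⁻¹ (Invertible-fromℕ-! d))) (Invertible-fromℕ+ τ≉-m s)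
      where
      factor : ∀ i → i < d → Invertible ((fromℕ s + τ - 1#) - fromℕ i)
      factor i i<d = Invertible-resp-≈ (begin
        fromℕ k + τ                                      ≈⟨ shift (fromℕ k) τ (fromℕ i) ⟩
        ((fromℕ k + (1# + fromℕ i)) + τ - 1#) - fromℕ i  ≈⟨ +-congʳ (+-congʳ (+-congʳ (fromℕ-+ k (suc i)))) ⟨
        (fromℕ (k ℕ.+ suc i) + τ - 1#) - fromℕ i         ≡⟨ ≡.cong (λ e → (fromℕ e + τ - 1#) - fromℕ i) k+1+i≡s ⟩
        (fromℕ s + τ - 1#) - fromℕ i                     ∎) (Invertible-fromℕ+ τ≉-m k)
        where
        k = s ℕ.∸ suc i
        k+1+i≡s : k ℕ.+ suc i ≡ s
        k+1+i≡s = ℕₚ.m∸n+n≡m (ℕₚ.≤-trans i<d d≤s)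
        shift : ∀ k τ i → k + τ ≈ ((k + (1# + i)) + τ - 1#) - i
        shift = solve 3 (λ k τ i → k :+ τ := ((k :+ (con (+ 1) :+ i)) :+ τ :- con (+ 1)) :- i) refl

    β-pascal : ∀ d b → β d b ≈ β (suc d) b + β d (suc b)
    β-pascal d b = ⁻¹≈⁻¹+⁻¹ (Invertible-βDen _ _ (ℕₚ.m≤m+n (suc d) b)) (Invertible-βDen _ _ (ℕₚ.m≤m+n d (suc b))) key
      where
      s  = fromℕ (d ℕ.+ b)
      z  = s + τ
      δ  = fromℕ d
      e  = fromℕ (suc d ℕ.!) ⁻¹
      F₋ = falling (z - 1#) d
      F₀ = falling z d
      1+s+τ-1≈z : (1# + s) + τ - 1# ≈ z
      1+s+τ-1≈z = solve 2 (λ s τ → (con (+ 1) :+ s) :+ τ :- con (+ 1) := s :+ τ) refl s τ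
      1+s+τ≈1+z : (1# + s) + τ ≈ 1# + z
      1+s+τ≈1+z = +-assoc _ _ _
      d!⁻¹≈[1+d]*e : fromℕ (d ℕ.!) ⁻¹ ≈ (1# + δ) * e
      d!⁻¹≈[1+d]*e = begin
        fromℕ (d ℕ.!) ⁻¹                                  ≈⟨ *-identityˡ _ ⟨
        1# * fromℕ (d ℕ.!) ⁻¹                             ≈⟨ *-congʳ (Invertible-fromℕ-suc d) ⟨
        ((1# + δ) * (1# + δ) ⁻¹) * fromℕ (d ℕ.!) ⁻¹        ≈⟨ *-assoc _ _ _ ⟩
        (1# + δ) * ((1# + δ) ⁻¹ * fromℕ (d ℕ.!) ⁻¹)        ≈⟨ *-congˡ (⁻¹-distrib-* (Invertible-fromℕ-suc d) (Invertible-fromℕ-! d)) ⟨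
        (1# + δ) * ((1# + δ) * fromℕ (d ℕ.!)) ⁻¹           ≈⟨ *-congˡ (⁻¹-cong (Invertible-* (Invertible-fromℕ-suc d) (Invertible-fromℕ-! d))
                                                                               (sym (fromℕ-* (suc d) (d ℕ.!)))) ⟩
        (1# + δ) * e                                       ∎
      A≈ : βDen s d ≈ F₋ * ((1# + δ) * e) * z
      A≈ = *-congʳ (*-congˡ d!⁻¹≈[1+d]*e)
      B≈ : βDen (1# + s) (suc d) ≈ (F₀ * (z - δ)) * e * (1# + z)
      B≈ = *-cong (*-congʳ (*-cong (falling-cong d 1+s+τ-1≈z) (+-congʳ 1+s+τ-1≈z))) 1+s+τ≈1+z
      C≈ : βDen (fromℕ (d ℕ.+ suc b)) d ≈ F₀ * ((1# + δ) * e) * (1# + z)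
      C≈ = begin
        βDen (fromℕ (d ℕ.+ suc b)) d ≡⟨ ≡.cong (λ k → βDen (fromℕ k) d) (ℕₚ.+-suc d b) ⟩
        βDen (1# + s) d              ≈⟨ *-cong (*-cong (falling-cong d 1+s+τ-1≈z) d!⁻¹≈[1+d]*e) 1+s+τ≈1+z ⟩
        F₀ * ((1# + δ) * e) * (1# + z)  ∎
      -- After clearing the common factors this is falling z d * (z - d) ≈ z * falling (z - 1) d.
      key : βDen (1# + s) (suc d) * βDen (fromℕ (d ℕ.+ suc b)) d
            ≈ βDen s d * (βDen (1# + s) (suc d) + βDen (fromℕ (d ℕ.+ suc b)) d)
      key = begin
        βDen (1# + s) (suc d) * βDen (fromℕ (d ℕ.+ suc b)) d
          ≈⟨ *-cong B≈ C≈ ⟩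
        ((F₀ * (z - δ)) * e * (1# + z)) * (F₀ * ((1# + δ) * e) * (1# + z))
          ≈⟨ gather F₀ (F₀ * (z - δ)) e z δ ⟩
        (F₀ * (z - δ)) * W
          ≈⟨ *-congʳ (falling-*-shift z d) ⟩
        (z * F₋) * W
          ≈⟨ spread F₀ z δ e F₋ ⟩
        F₋ * ((1# + δ) * e) * z * ((F₀ * (z - δ)) * e * (1# + z) + F₀ * ((1# + δ) * e) * (1# + z))
          ≈⟨ *-cong A≈ (+-cong B≈ C≈) ⟨
        βDen s d * (βDen (1# + s) (suc d) + βDen (fromℕ (d ℕ.+ suc b)) d) ∎
        where
        W = (1# + δ) * e * F₀ * e * (1# + z) * (1# + z)
        gather : ∀ F G e z δ → (G * e * (1# + z)) * (F * ((1# + δ) * e) * (1# + z))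
                               ≈ G * ((1# + δ) * e * F * e * (1# + z) * (1# + z))
        gather = solve 5 (λ F G e z δ → (G :* e :* (con (+ 1) :+ z)) :* (F :* ((con (+ 1) :+ δ) :* e) :* (con (+ 1) :+ z))
                                        := G :* ((con (+ 1) :+ δ) :* e :* F :* e :* (con (+ 1) :+ z) :* (con (+ 1) :+ z))) refl
        spread : ∀ F z δ e F₋ → (z * F₋) * ((1# + δ) * e * F * e * (1# + z) * (1# + z))
                                ≈ F₋ * ((1# + δ) * e) * z * ((F * (z - δ)) * e * (1# + z) + F * ((1# + δ) * e) * (1# + z))
        spread = solve 5 (λ F z δ e F₋ → (z :* F₋) :* ((con (+ 1) :+ δ) :* e :* F :* e :* (con (+ 1) :+ z) :* (con (+ 1) :+ z))
                                         := F₋ :* ((con (+ 1) :+ δ) :* e) :* z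
                                            :* ((F :* (z :- δ)) :* e :* (con (+ 1) :+ z) :+ F :* ((con (+ 1) :+ δ) :* e) :* (con (+ 1) :+ z))) refl

  -- Sums over one row of chains

  chainWeight : ∀ {q} → (Fin (suc q) → Carrier) → ℕ → (Fin (suc q) → ℕ) → Carrier
  chainWeight {q} x n ch = multinom n (nu ch) * prodFin (suc q) (λ j → pow (x j) (nu ch j))

  leadingNu : ∀ {q} → (Fin (suc q) → ℕ) → Fin q → ℕ
  leadingNu ch k = nu ch (inject₁ k)

  rowSum : ∀ {q} → (Fin (suc q) → Carrier) → ((Fin q → ℕ) → (Fin q → ℕ) → Carrier) → ℕ → Carrier
  rowSum {q} x Φ n = sumL (map (λ cs → chainWeight x n (n ∷ᵛ cs) * Φ (leadingNu (n ∷ᵛ cs)) ((n ∷ᵛ cs) ∘ suc)) (chainsBelow q n))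

  Extensional₂ : ∀ {q} → ((Fin q → ℕ) → (Fin q → ℕ) → Carrier) → Set ℓ
  Extensional₂ {q} Φ = ∀ {D D′ B B′ : Fin q → ℕ} → (∀ k → D k ≡ D′ k) → (∀ k → B k ≡ B′ k) → Φ D B ≈ Φ D′ B′

  MultiPascal : ∀ {q} → ((Fin q → ℕ) → (Fin q → ℕ) → Carrier) → Set ℓ
  MultiPascal {q} Φ = ∀ (k : Fin q) D B → Φ D B ≈ Φ (bump k D) B + Φ D (bump k B)

  rowSum-cong : ∀ {q} x {Φ Ψ : (Fin q → ℕ) → (Fin q → ℕ) → Carrier} → (∀ D B → Φ D B ≈ Ψ D B) → ∀ n → rowSum x Φ n ≈ rowSum x Ψ n
  rowSum-cong {q} x Φ≈Ψ n = sumL-cong (chainsBelow q n) (λ cs → *-congˡ (Φ≈Ψ _ _))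

  rowSum-+ : ∀ {q} x (Φ Φ₁ Φ₂ : (Fin q → ℕ) → (Fin q → ℕ) → Carrier) → (∀ D B → Φ D B ≈ Φ₁ D B + Φ₂ D B) → ∀ n →
    rowSum x Φ n ≈ rowSum x Φ₁ n + rowSum x Φ₂ n
  rowSum-+ {q} x Φ Φ₁ Φ₂ Φ≈Φ₁+Φ₂ n =
    trans (sumL-cong (chainsBelow q n) (λ cs → trans (*-congˡ (Φ≈Φ₁+Φ₂ _ _)) (distribˡ _ _ _))) (sumL-+ (chainsBelow q n) _ _)

  rowSum-length1 : ∀ (x : Fin 1 → Carrier) (Φ : (Fin 0 → ℕ) → (Fin 0 → ℕ) → Carrier) → Extensional₂ Φ → ∀ n →
    rowSum x Φ n ≈ pow (x zero) n * Φ (λ ()) (λ ())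
  rowSum-length1 x Φ ext n = begin
    (fromℕ (n ℕ.!) * (fromℕ (n ℕ.!) * 1#) ⁻¹ * (pow (x zero) n * 1#)) * Φ _ _ + 0#  ≈⟨ +-identityʳ _ ⟩
    (fromℕ (n ℕ.!) * (fromℕ (n ℕ.!) * 1#) ⁻¹ * (pow (x zero) n * 1#)) * Φ _ _       ≈⟨ *-cong (*-cong n!/n!≈1 (*-identityʳ _)) (ext (λ ()) (λ ())) ⟩
    (1# * pow (x zero) n) * Φ (λ ()) (λ ())                                          ≈⟨ *-congʳ (*-identityˡ _) ⟩
    pow (x zero) n * Φ (λ ()) (λ ())                                                 ∎
    where
    n!/n!≈1 : fromℕ (n ℕ.!) * (fromℕ (n ℕ.!) * 1#) ⁻¹ ≈ 1#
    n!/n!≈1 = trans (*-congˡ (⁻¹-cong (Invertible-* (Invertible-fromℕ-! n) Invertible-1) (*-identityʳ _))) (Invertible-fromℕ-! n)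

  chainWeight-∷ : ∀ {q} (x : Fin (suc (suc q)) → Carrier) n a (cs : Fin q → ℕ) → a ≤ n →
    chainWeight x n (n ∷ᵛ (a ∷ᵛ cs)) ≈ choose n a * (pow (x zero) (n ℕ.∸ a) * chainWeight (x ∘ suc) a (a ∷ᵛ cs))
  chainWeight-∷ {q} x n a cs a≤n = begin
    (fromℕ (n ℕ.!) * (f * P) ⁻¹) * (p₀ * p)                       ≈⟨ *-congʳ (*-cong n!≈ (⁻¹-distrib-* (Invertible-fromℕ-! (n ℕ.∸ a)) inv-P)) ⟩
    ((choose n a * (fromℕ (a ℕ.!) * f)) * (f ⁻¹ * P ⁻¹)) * (p₀ * p) ≈⟨ regroup (choose n a) (fromℕ (a ℕ.!)) f (f ⁻¹) (P ⁻¹) p₀ p ⟩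
    (choose n a * (p₀ * ((fromℕ (a ℕ.!) * P ⁻¹) * p))) * (f * f ⁻¹) ≈⟨ *-congˡ (Invertible-fromℕ-! (n ℕ.∸ a)) ⟩
    (choose n a * (p₀ * ((fromℕ (a ℕ.!) * P ⁻¹) * p))) * 1#         ≈⟨ *-identityʳ _ ⟩
    choose n a * (p₀ * ((fromℕ (a ℕ.!) * P ⁻¹) * p))                ∎
    where
    tail = a ∷ᵛ cs
    f  = fromℕ ((n ℕ.∸ a) ℕ.!)
    P  = prodFin (suc q) (λ j → fromℕ (nu tail j ℕ.!))
    p₀ = pow (x zero) (n ℕ.∸ a)
    p  = prodFin (suc q) (λ j → pow (x (suc j)) (nu tail j))
    inv-P : Invertible P
    inv-P = Invertible-prodFin (suc q) _ (λ j → Invertible-fromℕ-! (nu tail j))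
    n!≈ : fromℕ (n ℕ.!) ≈ choose n a * (fromℕ (a ℕ.!) * f)
    n!≈ = begin
      fromℕ (n ℕ.!)                                           ≡⟨ ≡.cong fromℕ (nCk*[k!*[n∸k]!]≡n! a≤n) ⟨
      fromℕ ((n C a) ℕ.* (a ℕ.! ℕ.* (n ℕ.∸ a) ℕ.!))         ≈⟨ fromℕ-* (n C a) _ ⟩
      choose n a * fromℕ (a ℕ.! ℕ.* (n ℕ.∸ a) ℕ.!)           ≈⟨ *-congˡ (fromℕ-* (a ℕ.!) ((n ℕ.∸ a) ℕ.!)) ⟩
      choose n a * (fromℕ (a ℕ.!) * f)                        ∎
    regroup : ∀ c a! f f′ P′ p₀ p → ((c * (a! * f)) * (f′ * P′)) * (p₀ * p) ≈ (c * (p₀ * ((a! * P′) * p))) * (f * f′)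
    regroup = solve 7 (λ c a! f f′ P′ p₀ p → ((c :* (a! :* f)) :* (f′ :* P′)) :* (p₀ :* p) := (c :* (p₀ :* ((a! :* P′) :* p))) :* (f :* f′)) refl

  module FirstCoordinate {q} (Φ : (Fin (suc q) → ℕ) → (Fin (suc q) → ℕ) → Carrier) (Φ-ext : Extensional₂ Φ) (Φ-pascal : MultiPascal Φ) where

    Ψ : ℕ → ℕ → (Fin q → ℕ) → (Fin q → ℕ) → Carrier
    Ψ d b D B = Φ (d ∷ᵛ D) (b ∷ᵛ B)

    Ψ-ext : ∀ d b → Extensional₂ (Ψ d b)
    Ψ-ext d b D≗D′ B≗B′ = Φ-ext (λ { zero → ≡.refl ; (suc k) → D≗D′ k }) (λ { zero → ≡.refl ; (suc k) → B≗B′ k })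

    Ψ-pascal : ∀ d b → MultiPascal (Ψ d b)
    Ψ-pascal d b k D B = trans (Φ-pascal (suc k) (d ∷ᵛ D) (b ∷ᵛ B))
                               (+-cong (Φ-ext (bump-suc-∷ k d D) (λ _ → ≡.refl)) (Φ-ext (λ _ → ≡.refl) (bump-suc-∷ k b B)))

    Ψ-pascal-first : ∀ d b D B → Ψ d b D B ≈ Ψ (suc d) b D B + Ψ d (suc b) D B
    Ψ-pascal-first d b D B = trans (Φ-pascal zero (d ∷ᵛ D) (b ∷ᵛ B))
                                   (+-cong (Φ-ext (bump-zero-∷ d D) (λ _ → ≡.refl)) (Φ-ext (λ _ → ≡.refl) (bump-zero-∷ b B)))

    module _ (x : Fin (suc (suc q)) → Carrier) where

      tailSum : ℕ → ℕ → ℕ → Carrier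
      tailSum l d b = rowSum (x ∘ suc) (Ψ d b) l

      tailSum-pascal : ∀ l → Pascal (tailSum l)
      tailSum-pascal l d b = rowSum-+ (x ∘ suc) (Ψ d b) _ _ (Ψ-pascal-first d b) l

      rowSum-decompose : ∀ n → rowSum x Φ n ≈ Σ[ a < suc n ] (choose n a * (pow (x zero) (n ℕ.∸ a) * tailSum a (n ℕ.∸ a) a))
      rowSum-decompose n = begin
        sumL (map f (concatMap (λ a → map (a ∷ᵛ_) (chainsBelow q a)) (upTo (suc n))))
          ≈⟨ sumL-concatMap (upTo (suc n)) (λ a → map (a ∷ᵛ_) (chainsBelow q a)) f ⟩
        sumL (map (λ a → sumL (map f (map (a ∷ᵛ_) (chainsBelow q a)))) (upTo (suc n)))
          ≈⟨ sumL-applyUpTo (suc n) id (λ a → sumL (map f (map (a ∷ᵛ_) (chainsBelow q a)))) ⟩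
        Σ[ a < suc n ] sumL (map f (map (a ∷ᵛ_) (chainsBelow q a)))
          ≈⟨ Σ-cong-< (suc n) (λ a a<1+n → firstEntry a (ℕₚ.≤-pred a<1+n)) ⟩
        Σ[ a < suc n ] (choose n a * (pow (x zero) (n ℕ.∸ a) * tailSum a (n ℕ.∸ a) a)) ∎
        where
        f : (Fin (suc q) → ℕ) → Carrier
        f cs = chainWeight x n (n ∷ᵛ cs) * Φ (leadingNu (n ∷ᵛ cs)) ((n ∷ᵛ cs) ∘ suc)
        reassoc : ∀ c p r φ → (c * (p * r)) * φ ≈ (c * p) * (r * φ)
        reassoc = solve 4 (λ c p r φ → (c :* (p :* r)) :* φ := (c :* p) :* (r :* φ)) refl
        firstEntry : ∀ a → a ≤ n → sumL (map f (map (a ∷ᵛ_) (chainsBelow q a))) ≈ choose n a * (pow (x zero) (n ℕ.∸ a) * tailSum a (n ℕ.∸ a) a)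
        firstEntry a a≤n = begin
          sumL (map f (map (a ∷ᵛ_) (chainsBelow q a)))
            ≈⟨ sumL-map (chainsBelow q a) (a ∷ᵛ_) f ⟩
          sumL (map (λ cs → f (a ∷ᵛ cs)) (chainsBelow q a))
            ≈⟨ sumL-cong (chainsBelow q a) (λ cs → trans (*-cong (chainWeight-∷ x n a cs a≤n)
                 (Φ-ext (λ { zero → ≡.refl ; (suc k) → ≡.refl }) (λ { zero → ≡.refl ; (suc k) → ≡.refl }))) (reassoc _ _ _ _)) ⟩
          sumL (map (λ cs → (choose n a * pow (x zero) (n ℕ.∸ a))
                            * (chainWeight (x ∘ suc) a (a ∷ᵛ cs) * Ψ (n ℕ.∸ a) a (leadingNu (a ∷ᵛ cs)) ((a ∷ᵛ cs) ∘ suc)))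
                    (chainsBelow q a))
            ≈⟨ sumL-*ˡ (chainsBelow q a) _ _ ⟩
          (choose n a * pow (x zero) (n ℕ.∸ a)) * tailSum a (n ℕ.∸ a) a
            ≈⟨ *-assoc _ _ _ ⟩
          choose n a * (pow (x zero) (n ℕ.∸ a) * tailSum a (n ℕ.∸ a) a) ∎

  RowInversion : ℕ → Set (c ⊔ ℓ)
  RowInversion q = ∀ (x : Fin (suc q) → Carrier) (Φ : (Fin q → ℕ) → (Fin q → ℕ) → Carrier) → Extensional₂ Φ → MultiPascal Φ →
    ∀ n → Σ[ j < suc n ] (choose n j * (sgn j * rowSum x Φ j)) ≈ rowSum (λ i → 1# - x i) Φ n

  rowInversion-zero : RowInversion 0
  rowInversion-zero x Φ Φ-ext _ n = begin
    Σ[ j < suc n ] (choose n j * (sgn j * rowSum x Φ j))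
      ≈⟨ Σ-cong (suc n) (λ j → trans (*-congˡ (*-congˡ (rowSum-length1 x Φ Φ-ext j))) (pull (choose n j) (sgn j) (pow (x zero) j) φ)) ⟩
    Σ[ j < suc n ] (φ * (choose n j * (sgn j * pow (x zero) j)))
      ≈⟨ Σ-*ˡ (suc n) φ (λ j → choose n j * (sgn j * pow (x zero) j)) ⟩
    φ * Σ[ j < suc n ] (choose n j * (sgn j * pow (x zero) j))
      ≈⟨ *-congˡ (binomialTheorem n (x zero)) ⟩
    φ * pow (1# - x zero) n
      ≈⟨ *-comm _ _ ⟩
    pow (1# - x zero) n * φ
      ≈⟨ rowSum-length1 (λ i → 1# - x i) Φ Φ-ext n ⟨
    rowSum (λ i → 1# - x i) Φ n ∎
    where
    φ = Φ (λ ()) (λ ())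
    pull : ∀ c s p φ → c * (s * (p * φ)) ≈ φ * (c * (s * p))
    pull = solve 4 (λ c s p φ → c :* (s :* (p :* φ)) := φ :* (c :* (s :* p))) refl

  -- After splitting off the first chain entry, both sides are trinomial double sums whose inner
  -- sums are matched by alternatingSum≈binomialSum for x₀; the other entries use the hypothesis.
  rowInversion-suc : ∀ {q} → RowInversion q → RowInversion (suc q)
  rowInversion-suc {q} IH x Φ Φ-ext Φ-pascal N = begin
    Σ[ j < suc N ] (choose N j * (sgn j * rowSum x Φ j))
      ≈⟨ Σ-cong (suc N) (λ j → *-congˡ (expandLeft j)) ⟩
    Σ[ j < suc N ] (choose N j * Σ[ a < suc j ] (choose j a * H₁ a (j ℕ.∸ a)))
      ≈⟨ Σ-trinomialRevision N H₁ ⟩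
    Σ[ a < suc N ] (choose N a * Σ[ k < suc (N ℕ.∸ a) ] (choose (N ℕ.∸ a) k * H₁ a k))
      ≈⟨ Σ-cong (suc N) (λ a → *-congˡ (trans (signLeft a)
           (*-congˡ (alternatingSum≈binomialSum (x zero) (tailSum x a) (tailSum-pascal x a) (N ℕ.∸ a) 0 a)))) ⟩
    Σ[ a < suc N ] (choose N a * (sgn a * binomialSum (x zero) (tailSum x a) (N ℕ.∸ a) 0 a))
      ≈⟨ Σ-cong (suc N) (λ a → *-congˡ (signRight a)) ⟨
    Σ[ a < suc N ] (choose N a * Σ[ k < suc (N ℕ.∸ a) ] (choose (N ℕ.∸ a) k * H₂ a k))
      ≈⟨ Σ-trinomialRevision N H₂ ⟨
    Σ[ j < suc N ] (choose N j * Σ[ a < suc j ] (choose j a * H₂ a (j ℕ.∸ a)))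
      ≈⟨ Σ-cong (suc N) (λ j → *-congˡ (expandRight j)) ⟨
    Σ[ j < suc N ] (choose N j * (pow (1# - x zero) (N ℕ.∸ j) * tailSum x′ j (N ℕ.∸ j) j))
      ≈⟨ rowSum-decompose x′ N ⟨
    rowSum x′ Φ N ∎
    where
    open FirstCoordinate Φ Φ-ext Φ-pascal
    x′ : Fin (suc (suc q)) → Carrier
    x′ i = 1# - x i
    H₁ : ℕ → ℕ → Carrier
    H₁ a k = sgn (a ℕ.+ k) * (pow (x zero) k * tailSum x a k a)
    H₂ : ℕ → ℕ → Carrier
    H₂ a k = sgn a * (pow (1# - x zero) (N ℕ.∸ (a ℕ.+ k)) * tailSum x a (N ℕ.∸ (a ℕ.+ k)) (a ℕ.+ k))
    expandLeft : ∀ j → sgn j * rowSum x Φ j ≈ Σ[ a < suc j ] (choose j a * H₁ a (j ℕ.∸ a))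
    expandLeft j = begin
      sgn j * rowSum x Φ j
        ≈⟨ *-congˡ (rowSum-decompose x j) ⟩
      sgn j * Σ[ a < suc j ] (choose j a * (pow (x zero) (j ℕ.∸ a) * tailSum x a (j ℕ.∸ a) a))
        ≈⟨ Σ-*ˡ (suc j) (sgn j) (λ a → choose j a * (pow (x zero) (j ℕ.∸ a) * tailSum x a (j ℕ.∸ a) a)) ⟨
      Σ[ a < suc j ] (sgn j * (choose j a * (pow (x zero) (j ℕ.∸ a) * tailSum x a (j ℕ.∸ a) a)))
        ≈⟨ Σ-cong-< (suc j) (λ a a<1+j → trans (swap _ _ _)
             (*-congˡ (*-congʳ (reflexive (≡.cong sgn (≡.sym (ℕₚ.m+[n∸m]≡n (ℕₚ.≤-pred a<1+j)))))))) ⟩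
      Σ[ a < suc j ] (choose j a * H₁ a (j ℕ.∸ a)) ∎
      where
      swap : ∀ s c t → s * (c * t) ≈ c * (s * t)
      swap = solve 3 (λ s c t → s :* (c :* t) := c :* (s :* t)) refl
    signLeft : ∀ a → Σ[ k < suc (N ℕ.∸ a) ] (choose (N ℕ.∸ a) k * H₁ a k) ≈ sgn a * alternatingSum (x zero) (tailSum x a) (N ℕ.∸ a) 0 a
    signLeft a = trans (Σ-cong (suc (N ℕ.∸ a)) (λ k → trans (*-congˡ (*-congʳ (sgn-+ a k))) (pull _ _ _ _)))
                       (Σ-*ˡ (suc (N ℕ.∸ a)) (sgn a) (λ k → choose (N ℕ.∸ a) k * (sgn k * (pow (x zero) k * tailSum x a k a))))
      where
      pull : ∀ c s s′ t → c * ((s * s′) * t) ≈ s * (c * (s′ * t))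
      pull = solve 4 (λ c s s′ t → c :* ((s :* s′) :* t) := s :* (c :* (s′ :* t))) refl
    signRight : ∀ a → Σ[ k < suc (N ℕ.∸ a) ] (choose (N ℕ.∸ a) k * H₂ a k) ≈ sgn a * binomialSum (x zero) (tailSum x a) (N ℕ.∸ a) 0 a
    signRight a = trans (Σ-cong (suc (N ℕ.∸ a)) pull-sgn)
                        (Σ-*ˡ (suc (N ℕ.∸ a)) (sgn a)
                              (λ k → choose (N ℕ.∸ a) k * (pow (1# - x zero) (N ℕ.∸ a ℕ.∸ k) * tailSum x a (N ℕ.∸ a ℕ.∸ k) (a ℕ.+ k))))
      where
      swap : ∀ c s t → c * (s * t) ≈ s * (c * t)
      swap = solve 3 (λ c s t → c :* (s :* t) := s :* (c :* t)) refl
      pull-sgn : ∀ k → choose (N ℕ.∸ a) k * H₂ a k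
                       ≈ sgn a * (choose (N ℕ.∸ a) k * (pow (1# - x zero) (N ℕ.∸ a ℕ.∸ k) * tailSum x a (N ℕ.∸ a ℕ.∸ k) (a ℕ.+ k)))
      pull-sgn k rewrite ≡.sym (ℕₚ.∸-+-assoc N a k) = swap _ _ _
    expandRight : ∀ j → pow (1# - x zero) (N ℕ.∸ j) * tailSum x′ j (N ℕ.∸ j) j ≈ Σ[ a < suc j ] (choose j a * H₂ a (j ℕ.∸ a))
    expandRight j = begin
      pow (1# - x zero) (N ℕ.∸ j) * tailSum x′ j (N ℕ.∸ j) j
        ≈⟨ *-congˡ (IH (x ∘ suc) (Ψ (N ℕ.∸ j) j) (Ψ-ext (N ℕ.∸ j) j) (Ψ-pascal (N ℕ.∸ j) j) j) ⟨
      pow (1# - x zero) (N ℕ.∸ j) * Σ[ a < suc j ] (choose j a * (sgn a * tailSum x a (N ℕ.∸ j) j))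
        ≈⟨ Σ-*ˡ (suc j) _ (λ a → choose j a * (sgn a * tailSum x a (N ℕ.∸ j) j)) ⟨
      Σ[ a < suc j ] (pow (1# - x zero) (N ℕ.∸ j) * (choose j a * (sgn a * tailSum x a (N ℕ.∸ j) j)))
        ≈⟨ Σ-cong-< (suc j) (λ a a<1+j → reorder a (ℕₚ.≤-pred a<1+j)) ⟩
      Σ[ a < suc j ] (choose j a * H₂ a (j ℕ.∸ a)) ∎
      where
      rotate : ∀ p c s g → p * (c * (s * g)) ≈ c * (s * (p * g))
      rotate = solve 4 (λ p c s g → p :* (c :* (s :* g)) := c :* (s :* (p :* g))) refl
      reorder : ∀ a → a ≤ j → pow (1# - x zero) (N ℕ.∸ j) * (choose j a * (sgn a * tailSum x a (N ℕ.∸ j) j)) ≈ choose j a * H₂ a (j ℕ.∸ a)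
      reorder a a≤j rewrite ℕₚ.m+[n∸m]≡n a≤j = rotate _ _ _ _

  rowInversion : ∀ q → RowInversion q
  rowInversion zero    = rowInversion-zero
  rowInversion (suc q) = rowInversion-suc (rowInversion q)

  _⊕_ : ∀ {q} → (Fin q → ℕ) → (Fin q → ℕ) → Fin q → ℕ
  (D ⊕ E) k = D k ℕ.+ E k

  bump-⊕ʳ : ∀ {q} (k : Fin q) D E j → bump k (D ⊕ E) j ≡ (D ⊕ bump k E) j
  bump-⊕ʳ k D E j with j ≟ k
  ... | yes _ = ≡.sym (ℕₚ.+-suc (D j) (E j))
  ... | no  _ = ≡.refl

  bump-⊕ˡ : ∀ {q} (k : Fin q) D E j → bump k (D ⊕ E) j ≡ (bump k D ⊕ E) j
  bump-⊕ˡ k D E j with j ≟ k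
  ... | yes _ = ≡.refl
  ... | no  _ = ≡.refl

  bump-≡ : ∀ {q} (k : Fin q) D → bump k D k ≡ suc (D k)
  bump-≡ k D with k ≟ k
  ... | yes _   = ≡.refl
  ... | no  k≢k = ⊥-elim (k≢k ≡.refl)

  bump-≢ : ∀ {q} (k j : Fin q) D → j ≢ k → bump k D j ≡ D j
  bump-≢ k j D j≢k with j ≟ k
  ... | yes j≡k = ⊥-elim (j≢k j≡k)
  ... | no  _   = ≡.refl

  prodFin-additiveAt : ∀ q (k : Fin q) (u v w : Fin q → Carrier) → u k ≈ v k + w k →
    (∀ j → j ≢ k → u j ≈ v j) → (∀ j → j ≢ k → u j ≈ w j) → prodFin q u ≈ prodFin q v + prodFin q w
  prodFin-additiveAt (suc q) zero u v w uₖ≈vₖ+wₖ u≈v u≈w = begin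
    u zero * prodFin q (u ∘ suc)                                 ≈⟨ *-cong uₖ≈vₖ+wₖ (prodFin-cong q (λ j → u≈v (suc j) (λ ()))) ⟩
    (v zero + w zero) * prodFin q (v ∘ suc)                      ≈⟨ distribʳ _ _ _ ⟩
    v zero * prodFin q (v ∘ suc) + w zero * prodFin q (v ∘ suc)
      ≈⟨ +-congˡ (*-congˡ (prodFin-cong q (λ j → trans (sym (u≈v (suc j) (λ ()))) (u≈w (suc j) (λ ()))))) ⟩
    v zero * prodFin q (v ∘ suc) + w zero * prodFin q (w ∘ suc)  ∎
  prodFin-additiveAt (suc q) (suc k) u v w uₖ≈vₖ+wₖ u≈v u≈w = begin
    u zero * prodFin q (u ∘ suc)
      ≈⟨ *-congˡ (prodFin-additiveAt q k (u ∘ suc) (v ∘ suc) (w ∘ suc) uₖ≈vₖ+wₖ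
                   (λ j j≢k → u≈v (suc j) (j≢k ∘ Fin.suc-injective)) (λ j j≢k → u≈w (suc j) (j≢k ∘ Fin.suc-injective))) ⟩
    u zero * (prodFin q (v ∘ suc) + prodFin q (w ∘ suc))
      ≈⟨ distribˡ _ _ _ ⟩
    u zero * prodFin q (v ∘ suc) + u zero * prodFin q (w ∘ suc)
      ≈⟨ +-cong (*-congʳ (u≈v zero (λ ()))) (*-congʳ (u≈w zero (λ ()))) ⟩
    v zero * prodFin q (v ∘ suc) + w zero * prodFin q (w ∘ suc) ∎

  Nonincreasing : ∀ {q} → (Fin (suc q) → ℕ) → Set
  Nonincreasing {q} ch = ∀ (k : Fin q) → ch (suc k) ≤ ch (inject₁ k)

  chainsBelow-nonincreasing : ∀ q b → All (λ cs → Nonincreasing (b ∷ᵛ cs)) (chainsBelow q b)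
  chainsBelow-nonincreasing zero    b = (λ ()) ∷ []
  chainsBelow-nonincreasing (suc q) b = All.concat⁺ (All.map⁺ (All.applyUpTo⁺₁ id (suc b) (λ {a} a<1+b →
    All.map⁺ (All.map (λ cs↓ → λ { zero → ℕₚ.≤-pred a<1+b ; (suc k) → cs↓ k }) (chainsBelow-nonincreasing q a)))))

  chains-nonincreasing : ∀ q n → All Nonincreasing (chains q n)
  chains-nonincreasing q n = All.map⁺ (chainsBelow-nonincreasing q n)

  tuples-All : ∀ {a p} {A : Set a} {P : A → Set p} r (L : Fin r → List A) → (∀ i → All P (L i)) → All (λ N → ∀ i → P (N i)) (tuples r L)
  tuples-All zero    L all = (λ ()) ∷ []
  tuples-All (suc r) L all = All.concat⁺ (All.map⁺ (All.map (λ {a} Pa →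
    All.map⁺ (All.map (λ PN → λ { zero → Pa ; (suc i) → PN i }) (tuples-All r (L ∘ suc) (all ∘ suc)))) (all zero)))

  nextEntry-inject₁ : ∀ {q} (ch : Fin (suc q) → ℕ) (k : Fin q) → nextEntry ch (inject₁ k) ≡ ch (suc k)
  nextEntry-inject₁ {suc q} ch zero    = ≡.refl
  nextEntry-inject₁ {suc q} ch (suc k) = nextEntry-inject₁ (ch ∘ suc) k

  sumℕ-+ : ∀ r (f g : Fin r → ℕ) → sumℕ r (λ i → f i ℕ.+ g i) ≡ sumℕ r f ℕ.+ sumℕ r g
  sumℕ-+ zero    f g = ≡.refl
  sumℕ-+ (suc r) f g = ≡.trans (≡.cong (f zero ℕ.+ g zero ℕ.+_) (sumℕ-+ r (f ∘ suc) (g ∘ suc)))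
                               (interchange (f zero) (g zero) (sumℕ r (f ∘ suc)) (sumℕ r (g ∘ suc)))
    where open import Algebra.Properties.CommutativeSemigroup ℕₚ.+-commutativeSemigroup using (interchange)

  sumℕ-cong : ∀ r {f g : Fin r → ℕ} → (∀ i → f i ≡ g i) → sumℕ r f ≡ sumℕ r g
  sumℕ-cong zero    f≗g = ≡.refl
  sumℕ-cong (suc r) f≗g = ≡.cong₂ ℕ._+_ (f≗g zero) (sumℕ-cong r (f≗g ∘ suc))

  module Coefficients {q} {t : Fin q → Carrier} (t≉-m : ∀ j m → ¬ (t j ≈ - fromℕ m)) where

    βₖ : Fin q → ℕ → ℕ → Carrier
    βₖ k = Beta.β (t≉-m k)

    -- The coefficient with the accumulated exponent sums D, B of the rows already summed over.
    rowwiseCoeff : ∀ r → (D B : Fin q → ℕ) → (Fin r → Fin (suc q) → Carrier) → (Fin r → ℕ) → Carrier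
    rowwiseCoeff zero    D B x n = prodFin q (λ k → βₖ k (D k) (B k))
    rowwiseCoeff (suc r) D B x n = rowSum (x zero) (λ D′ B′ → rowwiseCoeff r (D ⊕ D′) (B ⊕ B′) (x ∘ suc) (n ∘ suc)) (n zero)

    rowwiseCoeff-cong : ∀ r {D D′ B B′} x n → (∀ k → D k ≡ D′ k) → (∀ k → B k ≡ B′ k) → rowwiseCoeff r D B x n ≈ rowwiseCoeff r D′ B′ x n
    rowwiseCoeff-cong zero    x n D≗D′ B≗B′ = prodFin-cong q (λ k → reflexive (≡.cong₂ (βₖ k) (D≗D′ k) (B≗B′ k)))
    rowwiseCoeff-cong (suc r) x n D≗D′ B≗B′ =
      rowSum-cong (x zero) (λ E F → rowwiseCoeff-cong r (x ∘ suc) (n ∘ suc) (λ k → ≡.cong (ℕ._+ E k) (D≗D′ k)) (λ k → ≡.cong (ℕ._+ F k) (B≗B′ k))) (n zero)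

    rowwiseCoeff-extensional : ∀ r D B x → Extensional (rowwiseCoeff r D B x)
    rowwiseCoeff-extensional zero    D B x n≗n′ = refl
    rowwiseCoeff-extensional (suc r) D B x {n} {n′} n≗n′ =
      trans (reflexive (≡.cong (rowSum (x zero) (λ E F → rowwiseCoeff r (D ⊕ E) (B ⊕ F) (x ∘ suc) (n ∘ suc))) (n≗n′ zero)))
            (rowSum-cong (x zero) (λ E F → rowwiseCoeff-extensional r (D ⊕ E) (B ⊕ F) (x ∘ suc) (n≗n′ ∘ suc)) (n′ zero))

    rowwiseCoeff-pascal : ∀ r (k : Fin q) D B x n → rowwiseCoeff r D B x n ≈ rowwiseCoeff r (bump k D) B x n + rowwiseCoeff r D (bump k B) x n
    rowwiseCoeff-pascal zero    k D B x n = prodFin-additiveAt q k _ _ _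
      (trans (Beta.β-pascal (t≉-m k) (D k) (B k))
             (sym (+-cong (reflexive (≡.cong (λ d → βₖ k d (B k)) (bump-≡ k D))) (reflexive (≡.cong (βₖ k (D k)) (bump-≡ k B))))))
      (λ j j≢k → reflexive (≡.cong (λ d → βₖ j d (B j)) (≡.sym (bump-≢ k j D j≢k))))
      (λ j j≢k → reflexive (≡.cong (βₖ j (D j)) (≡.sym (bump-≢ k j B j≢k))))
    rowwiseCoeff-pascal (suc r) k D B x n = rowSum-+ (x zero) _ _ _ (λ E F →
      trans (rowwiseCoeff-pascal r k (D ⊕ E) (B ⊕ F) (x ∘ suc) (n ∘ suc))
            (+-cong (rowwiseCoeff-cong r (x ∘ suc) (n ∘ suc) (bump-⊕ˡ k D E) (λ _ → ≡.refl))
                    (rowwiseCoeff-cong r (x ∘ suc) (n ∘ suc) (λ _ → ≡.refl) (bump-⊕ˡ k B F)))) (n zero)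

    nabla-rowwiseCoeff : ∀ r D B x n → nabla (rowwiseCoeff r D B x) n ≈ rowwiseCoeff r D B (oneMinus x) n
    nabla-rowwiseCoeff zero    D B x n = refl
    nabla-rowwiseCoeff (suc r) D B x n = begin
      nabla (rowwiseCoeff (suc r) D B x) n
        ≈⟨ nabla-expandFirst r (rowwiseCoeff (suc r) D B x) (rowwiseCoeff-extensional (suc r) D B x) n ⟩
      Σ[ j < suc (n zero) ] (choose (n zero) j * (sgn j * nabla (λ m → rowwiseCoeff (suc r) D B x (j ∷ᵛ m)) (n ∘ suc)))
        ≈⟨ Σ-cong (suc (n zero)) (λ j → *-congˡ (*-congˡ (nabla-row j))) ⟩
      Σ[ j < suc (n zero) ] (choose (n zero) j * (sgn j * rowSum (x zero) Φ j))
        ≈⟨ rowInversion q (x zero) Φ Φ-ext Φ-pascal (n zero) ⟩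
      rowwiseCoeff (suc r) D B (oneMinus x) n ∎
      where
      Φ : (Fin q → ℕ) → (Fin q → ℕ) → Carrier
      Φ E F = rowwiseCoeff r (D ⊕ E) (B ⊕ F) (oneMinus x ∘ suc) (n ∘ suc)
      Φ-ext : Extensional₂ Φ
      Φ-ext E≗E′ F≗F′ = rowwiseCoeff-cong r _ _ (λ k → ≡.cong (D k ℕ.+_) (E≗E′ k)) (λ k → ≡.cong (B k ℕ.+_) (F≗F′ k))
      Φ-pascal : MultiPascal Φ
      Φ-pascal k E F = trans (rowwiseCoeff-pascal r k (D ⊕ E) (B ⊕ F) _ _)
                             (+-cong (rowwiseCoeff-cong r _ _ (bump-⊕ʳ k D E) (λ _ → ≡.refl)) (rowwiseCoeff-cong r _ _ (λ _ → ≡.refl) (bump-⊕ʳ k B F)))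
      nabla-row : ∀ j → nabla (λ m → rowwiseCoeff (suc r) D B x (j ∷ᵛ m)) (n ∘ suc) ≈ rowSum (x zero) Φ j
      nabla-row j = trans (nabla-linear r (chainsBelow q j) (λ cs → chainWeight (x zero) j (j ∷ᵛ cs))
                             (λ cs m → rowwiseCoeff r (D ⊕ leadingNu (j ∷ᵛ cs)) (B ⊕ ((j ∷ᵛ cs) ∘ suc)) (x ∘ suc) m) (n ∘ suc))
                          (sumL-cong (chainsBelow q j) (λ cs → *-congˡ (nabla-rowwiseCoeff r _ _ (x ∘ suc) (n ∘ suc))))

    numerator : ∀ r → (Fin r → Fin (suc q) → Carrier) → (Fin r → ℕ) → (Fin r → Fin (suc q) → ℕ) → Carrier
    numerator r x n N = prodFin r (λ i → chainWeight (x i) (n i) (N i))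

    νSum : ∀ r → (Fin r → Fin (suc q) → ℕ) → Fin q → ℕ
    νSum r N k = sumℕ r (λ i → nu (N i) (inject₁ k))

    nextSum : ∀ r → (Fin r → Fin (suc q) → ℕ) → Fin q → ℕ
    nextSum r N k = sumℕ r (λ i → N i (suc k))

    shiftedCoeff : ∀ r → (D B : Fin q → ℕ) → (Fin r → Fin (suc q) → Carrier) → (Fin r → ℕ) → Carrier
    shiftedCoeff r D B x n = sumL (map (λ N → numerator r x n N * prodFin q (λ k → βₖ k (D k ℕ.+ νSum r N k) (B k ℕ.+ nextSum r N k)))
                                       (tuples r (λ i → chains q (n i))))

    shiftedCoeff≈rowwiseCoeff : ∀ r D B x n → shiftedCoeff r D B x n ≈ rowwiseCoeff r D B x n
    shiftedCoeff≈rowwiseCoeff zero D B x n =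
      trans (+-identityʳ _) (trans (*-identityˡ _) (prodFin-cong q (λ k → reflexive (≡.cong₂ (βₖ k) (ℕₚ.+-identityʳ (D k)) (ℕₚ.+-identityʳ (B k))))))
    shiftedCoeff≈rowwiseCoeff (suc r) D B x n = begin
      sumL (map T (concatMap (λ ch → map (ch ∷ᵛ_) (tuples r (L ∘ suc))) (map (n zero ∷ᵛ_) (chainsBelow q (n zero)))))
        ≈⟨ sumL-concatMap (map (n zero ∷ᵛ_) (chainsBelow q (n zero))) (λ ch → map (ch ∷ᵛ_) (tuples r (L ∘ suc))) T ⟩
      sumL (map (λ ch → sumL (map T (map (ch ∷ᵛ_) (tuples r (L ∘ suc))))) (map (n zero ∷ᵛ_) (chainsBelow q (n zero))))
        ≈⟨ sumL-map (chainsBelow q (n zero)) (n zero ∷ᵛ_) _ ⟩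
      sumL (map (λ cs → sumL (map T (map ((n zero ∷ᵛ cs) ∷ᵛ_) (tuples r (L ∘ suc))))) (chainsBelow q (n zero)))
        ≈⟨ sumL-cong (chainsBelow q (n zero)) firstRow ⟩
      rowwiseCoeff (suc r) D B x n ∎
      where
      L : Fin (suc r) → List (Fin (suc q) → ℕ)
      L i = chains q (n i)
      T : (Fin (suc r) → Fin (suc q) → ℕ) → Carrier
      T N = numerator (suc r) x n N * prodFin q (λ k → βₖ k (D k ℕ.+ νSum (suc r) N k) (B k ℕ.+ nextSum (suc r) N k))
      firstRow : ∀ cs → sumL (map T (map ((n zero ∷ᵛ cs) ∷ᵛ_) (tuples r (L ∘ suc))))
                        ≈ chainWeight (x zero) (n zero) (n zero ∷ᵛ cs) * rowwiseCoeff r (D ⊕ leadingNu (n zero ∷ᵛ cs)) (B ⊕ ((n zero ∷ᵛ cs) ∘ suc)) (x ∘ suc) (n ∘ suc)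
      firstRow cs = begin
        sumL (map T (map (ch ∷ᵛ_) (tuples r (L ∘ suc))))
          ≈⟨ sumL-map (tuples r (L ∘ suc)) (ch ∷ᵛ_) T ⟩
        sumL (map (λ N → T (ch ∷ᵛ N)) (tuples r (L ∘ suc)))
          ≈⟨ sumL-cong (tuples r (L ∘ suc)) (λ N → trans (*-congˡ (prodFin-cong q (λ k → reflexive (≡.cong₂ (βₖ k)
                (≡.sym (ℕₚ.+-assoc (D k) (nu ch (inject₁ k)) (νSum r N k))) (≡.sym (ℕₚ.+-assoc (B k) (ch (suc k)) (nextSum r N k)))))))
              (*-assoc _ _ _)) ⟩
        sumL (map (λ N → chainWeight (x zero) (n zero) ch * (numerator r (x ∘ suc) (n ∘ suc) N
                          * prodFin q (λ k → βₖ k ((D ⊕ leadingNu ch) k ℕ.+ νSum r N k) ((B ⊕ (ch ∘ suc)) k ℕ.+ nextSum r N k))))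
                  (tuples r (L ∘ suc)))
          ≈⟨ sumL-*ˡ (tuples r (L ∘ suc)) _ _ ⟩
        chainWeight (x zero) (n zero) ch * shiftedCoeff r (D ⊕ leadingNu ch) (B ⊕ (ch ∘ suc)) (x ∘ suc) (n ∘ suc)
          ≈⟨ *-congˡ (shiftedCoeff≈rowwiseCoeff r _ _ (x ∘ suc) (n ∘ suc)) ⟩
        chainWeight (x zero) (n zero) ch * rowwiseCoeff r (D ⊕ leadingNu ch) (B ⊕ (ch ∘ suc)) (x ∘ suc) (n ∘ suc) ∎
        where ch = n zero ∷ᵛ cs

    entrySum : ∀ r → (Fin r → Fin (suc q) → ℕ) → Fin q → ℕ
    entrySum r N k = sumℕ r (λ i → N i (inject₁ k))

    entrySum≡νSum+nextSum : ∀ r N → (∀ i → Nonincreasing (N i)) → ∀ k → entrySum r N k ≡ νSum r N k ℕ.+ nextSum r N k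
    entrySum≡νSum+nextSum r N N↓ k = ≡.trans (sumℕ-cong r entry≡ν+next) (sumℕ-+ r _ _)
      where
      entry≡ν+next : ∀ i → N i (inject₁ k) ≡ nu (N i) (inject₁ k) ℕ.+ N i (suc k)
      entry≡ν+next i = ≡.sym (≡.trans (≡.cong (λ e → N i (inject₁ k) ℕ.∸ e ℕ.+ N i (suc k)) (nextEntry-inject₁ (N i) k))
                                      (ℕₚ.m∸n+n≡m (N↓ i k)))

    coeffTerm≈ : ∀ r x n N → (∀ i → Nonincreasing (N i)) →
      numerator r x n N * prodFin q (λ k → Beta.βDen (t≉-m k) (fromℕ (entrySum r N k)) (νSum r N k)) ⁻¹
        ≈ numerator r x n N * prodFin q (λ k → βₖ k (νSum r N k) (nextSum r N k))
    coeffTerm≈ r x n N N↓ = *-congˡ (trans (⁻¹-prodFin q _ invertible-den) (prodFin-cong q (λ k → reflexive (≡.cong _⁻¹ (den≡ k)))))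
      where
      den≡ : ∀ k → Beta.βDen (t≉-m k) (fromℕ (entrySum r N k)) (νSum r N k)
                   ≡ Beta.βDen (t≉-m k) (fromℕ (νSum r N k ℕ.+ nextSum r N k)) (νSum r N k)
      den≡ k = ≡.cong (λ s → Beta.βDen (t≉-m k) (fromℕ s) (νSum r N k)) (entrySum≡νSum+nextSum r N N↓ k)
      invertible-den : ∀ k → Invertible (Beta.βDen (t≉-m k) (fromℕ (entrySum r N k)) (νSum r N k))
      invertible-den k = Invertible-resp-≈ (reflexive (≡.sym (den≡ k)))
                                           (Beta.Invertible-βDen (t≉-m k) _ _ (ℕₚ.m≤m+n (νSum r N k) (nextSum r N k)))

    coeff≈shiftedCoeff : ∀ r x n → coeff t x n ≈ shiftedCoeff r (λ _ → 0) (λ _ → 0) x n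
    coeff≈shiftedCoeff r x n =
      sumL-cong-All (All.map (coeffTerm≈ r x n _) (tuples-All r (λ i → chains q (n i)) (λ i → chains-nonincreasing q (n i))))

    coeff≈rowwiseCoeff : ∀ r x n → coeff t x n ≈ rowwiseCoeff r (λ _ → 0) (λ _ → 0) x n
    coeff≈rowwiseCoeff r x n = trans (coeff≈shiftedCoeff r x n) (shiftedCoeff≈rowwiseCoeff r _ _ x n)

theorem3p6 : ∀ {c ℓ} (F : CharZeroField c ℓ) → let open Ops F in
    (r q : ℕ) → 1 ≤ r →
    (x : Fin r → Fin (suc q) → Carrier) →
    (t : Fin q → Carrier) →
    (∀ (j : Fin q) (m : ℕ) → ¬ (t j ≈ - fromℕ m)) →
    ∀ (n : Fin r → ℕ) → nabla (coeff t x) n ≈ coeff t (oneMinus x) n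
theorem3p6 F r q _ x t t≉-m n = begin
  nabla (coeff t x) n                                ≈⟨ nabla-cong r (coeff≈rowwiseCoeff r x) n ⟩
  nabla (rowwiseCoeff r (λ _ → 0) (λ _ → 0) x) n     ≈⟨ nabla-rowwiseCoeff r _ _ x n ⟩
  rowwiseCoeff r (λ _ → 0) (λ _ → 0) (oneMinus x) n  ≈⟨ coeff≈rowwiseCoeff r (oneMinus x) n ⟨
  coeff t (oneMinus x) n                             ∎
  where
  open Ops F
  open Development F
  open Coefficients t≉-m
  open import Relation.Binary.Reasoning.Setoid (CommutativeRing.setoid commRing)
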